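{- Let $\underline A=(A;(\varrho_m)_{1\le m\in\omega})$ be an infinite structure, where each $\varrho_m$ is an $m$-ary relation on $A$, and let $\underline A^{[m]}=(A;\varrho_1,\dots,\varrho_m)$. Assume: (1) the first-order theory $\mathrm{Th}(\underline A)$ is $\omega$-categorical; (2) for every $m$, the set $\{\varrho_1,\dots,\varrho_m\}$ is homogeneous; (3) $\underline A$ is rigid, i.e. its only automorphism is the identity. Let $R=\langle\varrho_1,\varrho_2,\dots\rangle_{KA}$ (the set of relations first-order definable without parameters in $\underline A$). Then for every $m$, $\langle\varrho_1,\dots,\varrho_m\rangle_{KA}=\mathrm{sInv}\,\mathrm{Aut}\{\varrho_1,\dots,\varrho_m\}$, and $R=\bigcup_m\langle\varrho_1,\dots,\varrho_m\rangle_{KA}$, but $R=\langle R\rangle_{inv,\bigcap}\subsetneq\mathrm{sInv}\,\mathrm{Aut}\,R$.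
   Context: $\mathrm{Rel}(A)$ is the set of all finitary relations (subsets of $A^m$, $m\ge1$) on $A$. For a permutation $g$ of $A$, $g[\varrho]=\{(g(a_1),\dots,g(a_m))\mid(a_1,\dots,a_m)\in\varrho\}$. $\mathrm{Aut}\,Q$ is the set of permutations $g$ of $A$ with $g[\varrho]=\varrho$ for all $\varrho\in Q$; $\mathrm{sInv}\,G$ is the set of $\varrho\in\mathrm{Rel}(A)$ with $g[\varrho]=\varrho$ for all $g\in G$. A logical operation is an operation $L_\varphi(\sigma_1,\dots,\sigma_n)=\{\underline a\in A^k\mid (A;\sigma_1,\dots,\sigma_n)\models\varphi(\underline a)\}$ for a first-order formula $\varphi$ (with equality) in predicate symbols for the $\sigma_i$, with free variables among $x_1,\dots,x_k$; $\langle Q\rangle_{KA}$ is the closure of $Q$ under all logical operations. An operation $F$ from $\mathrm{Rel}^{(m_1)}(A)\times\dots\times\mathrm{Rel}^{(m_n)}(A)$ to $\mathrm{Rel}^{(k)}(A)$ is invariant if $F(g[\sigma_1],\dots,g[\sigma_n])=g[F(\sigma_1,\dots,\sigma_n)]$ for all permutations $g$ of $A$. $\langle Q\rangle_{inv,\bigcap}$ is the least set of relations containing $Q$, closed under all invariant operations, containing all $A^k$, and closed under arbitrary intersections of relations of the same arity. A finite set $Q$ of relations is homogeneous if every finite partial automorphism of $Q$ (a bijection $f$ between finite subsets of $A$ such that for all $\sigma\in Q$ of arity $k$ and $a_1,\dots,a_k\in\mathrm{dom} f$: $\sigma(a_1,\dots,a_k)\iff\sigma(f(a_1),\dots,f(a_k))$)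 extends to an element of $\mathrm{Aut}\,Q$. -}

module Defs where

open import Level using (Level; _⊔_; 0ℓ) renaming (suc to lsuc)
open import Data.Nat using (ℕ; zero; suc; _≤_)
open import Data.Fin using (Fin; zero; suc)
open import Data.Product using (Σ; _×_; _,_)
open import Relation.Nullary using (¬_)
open import Relation.Binary.PropositionalEquality using (_≡_)
open import Function.Bundles using (_↔_; _⇔_; Inverse)
open import Function.Base using (_∘_)

-- Rel(A) = relations of arity ≥ 1;
-- the arity condition 1 ≤ k is imposed in every set of relations below.

Rel : Set → ℕ → Set₁
Rel A k = (Fin k → A) → Set

_≐_ : ∀ {A k} → Rel A k → Rel A k → Set
σ ≐ τ = ∀ a → σ a ⇔ τ a

RelSet : Set → (ℓ : Level) → Set (lsuc 0ℓ ⊔ lsuc ℓ)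
RelSet A ℓ = (k : ℕ) → Rel A k → Set ℓ

_≈ₛ_ : ∀ {A ℓ ℓ'} → RelSet A ℓ → RelSet A ℓ' → Set (lsuc 0ℓ ⊔ ℓ ⊔ ℓ')
P ≈ₛ Q = ∀ k → 1 ≤ k → ∀ σ → P k σ ⇔ Q k σ

_⊆ₛ_ : ∀ {A ℓ ℓ'} → RelSet A ℓ → RelSet A ℓ' → Set (lsuc 0ℓ ⊔ ℓ ⊔ ℓ')
P ⊆ₛ Q = ∀ k → 1 ≤ k → ∀ σ → P k σ → Q k σ

Perm : Set → Set
Perm A = A ↔ A

image : ∀ {A k} → Perm A → Rel A k → Rel A k
image {A} {k} g σ b =
  Σ (Fin k → A) λ a → σ a × (∀ i → b i ≡ Inverse.to g (a i))

Aut : ∀ {A ℓ} → RelSet A ℓ → Perm A → Set (lsuc 0ℓ ⊔ ℓ)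
Aut Q g = ∀ k σ → Q k σ → image g σ ≐ σ

sInv : ∀ {A ℓ} → (Perm A → Set ℓ) → RelSet A ℓ
sInv G k σ = 1 ≤ k × (∀ g → G g → image g σ ≐ σ)

-- First-order formulas with equality over a relational signature
-- (Sym, ar); variables in scope are Fin k (free variables among
-- x₁,…,xₖ).  Connectives ¬, ∧, ∃ (a complete set classically).

data Formula (Sym : Set) (ar : Sym → ℕ) : ℕ → Set where
  atom  : ∀ {k} (s : Sym) → (Fin (ar s) → Fin k) → Formula Sym ar k
  equal : ∀ {k} → Fin k → Fin k → Formula Sym ar k
  neg   : ∀ {k} → Formula Sym ar k → Formula Sym ar k
  and   : ∀ {k} → Formula Sym ar k → Formula Sym ar k → Formula Sym ar k
  ex    : ∀ {k} → Formula Sym ar (suc k) → Formula Sym ar k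

extend : ∀ {B : Set} {k} → B → (Fin k → B) → Fin (suc k) → B
extend x b zero    = x
extend x b (suc i) = b i

Sat : ∀ {Sym ar} {B : Set} → ((s : Sym) → Rel B (ar s)) →
      ∀ {k} → Formula Sym ar k → (Fin k → B) → Set
Sat I (atom s v)  b = I s (b ∘ v)
Sat I (equal x y) b = b x ≡ b y
Sat I (neg φ)     b = ¬ Sat I φ b
Sat I (and φ ψ)   b = Sat I φ b × Sat I ψ b
Sat {B = B} I (ex φ) b = Σ B λ x → Sat I φ (extend x b)

L : ∀ {A : Set} {n} {ar : Fin n → ℕ} {k} →
    Formula (Fin n) ar k → ((i : Fin n) → Rel A (ar i)) → Rel A k
L φ σs a = Sat σs φ a

data KA {A : Set} {ℓ} (Q : RelSet A ℓ) : (k : ℕ) → Rel A k → Set (lsuc 0ℓ ⊔ ℓ) where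
  base    : ∀ {k σ} → Q k σ → KA Q k σ
  logical : ∀ {n k} (ar : Fin n → ℕ) (σs : (i : Fin n) → Rel A (ar i)) →
            (∀ i → KA Q (ar i) (σs i)) → 1 ≤ k →
            (φ : Formula (Fin n) ar k) → ∀ {τ} → τ ≐ L φ σs → KA Q k τ

Extensional : ∀ {A : Set} {n} {ms : Fin n → ℕ} {k} →
              (((i : Fin n) → Rel A (ms i)) → Rel A k) → Set₁
Extensional F = ∀ σs σs' → (∀ i → σs i ≐ σs' i) → F σs ≐ F σs'

Invariant : ∀ {A : Set} {n} {ms : Fin n → ℕ} {k} →
            (((i : Fin n) → Rel A (ms i)) → Rel A k) → Set₁
Invariant {A} F = ∀ (g : Perm A) σs → F (λ i → image g (σs i)) ≐ image g (F σs)

data InvCl {A : Set} {ℓ} (Q : RelSet A ℓ) : (k : ℕ) → Rel A k → Set (lsuc (lsuc 0ℓ) ⊔ ℓ) where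
  base  : ∀ {k σ} → Q k σ → InvCl Q k σ
  op    : ∀ {n k} (ms : Fin n → ℕ) → (∀ i → 1 ≤ ms i) → 1 ≤ k →
          (F : ((i : Fin n) → Rel A (ms i)) → Rel A k) →
          Extensional F → Invariant F →
          (σs : (i : Fin n) → Rel A (ms i)) → (∀ i → InvCl Q (ms i) (σs i)) →
          ∀ {τ} → τ ≐ F σs → InvCl Q k τ
  full  : ∀ {k} → 1 ≤ k → ∀ {τ} → (∀ a → τ a) → InvCl Q k τ
  inter : ∀ {k} → 1 ≤ k → (S : Rel A k → Set₁) → (∀ σ → S σ → InvCl Q k σ) →
          ∀ {τ} → (∀ a → τ a ⇔ (∀ σ → S σ → σ a)) → InvCl Q k τ

Injective : ∀ {A : Set} {n} → (Fin n → A) → Set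
Injective a = ∀ i j → a i ≡ a j → i ≡ j

PartialAut : ∀ {A ℓ} → RelSet A ℓ → ∀ {n} → (Fin n → A) → (Fin n → A) → Set (lsuc 0ℓ ⊔ ℓ)
PartialAut Q {n} a b = Injective a × Injective b ×
  (∀ k σ → Q k σ → (j : Fin k → Fin n) → σ (a ∘ j) ⇔ σ (b ∘ j))

Homogeneous : ∀ {A ℓ} → RelSet A ℓ → Set (lsuc 0ℓ ⊔ ℓ)
Homogeneous {A} Q = ∀ n (a b : Fin n → A) → PartialAut Q a b →
  Σ (Perm A) λ g → Aut Q g × (∀ i → Inverse.to g (a i) ≡ b i)

Infinite : Set → Set
Infinite A = ¬ (Σ ℕ λ n → A ↔ Fin n)

-- the structure A = (A; ϱ_m)_{m ≥ 1}, with ϱ : (m : ℕ) → Rel A m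
-- (ϱ 0 is ignored).  Signature: symbol s : ℕ of arity suc s, naming ϱ_{s+1}.
Ar : ℕ → ℕ
Ar s = suc s

Interp : ∀ {A} → ((m : ℕ) → Rel A m) → (s : ℕ) → Rel A (Ar s)
Interp ρ s = ρ (suc s)

Sentence : Set
Sentence = Formula ℕ Ar 0

empty : ∀ {B : Set} → Fin 0 → B
empty ()

ModelOfTh : ∀ {A B : Set} → ((m : ℕ) → Rel A m) → ((s : ℕ) → Rel B (Ar s)) → Set
ModelOfTh ρ I = (φ : Sentence) → Sat (Interp ρ) φ empty → Sat I φ empty

OmegaCategorical : ∀ {A : Set} → ((m : ℕ) → Rel A m) → Set₁
OmegaCategorical ρ =
  (B C : Set) (IB : (s : ℕ) → Rel B (Ar s)) (IC : (s : ℕ) → Rel C (Ar s)) →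
  B ↔ ℕ → C ↔ ℕ → ModelOfTh ρ IB → ModelOfTh ρ IC →
  Σ (B ↔ C) λ h → ∀ s b → IB s b ⇔ IC s (Inverse.to h ∘ b)

Upto : ∀ {A} → ((m : ℕ) → Rel A m) → ℕ → RelSet A 0ℓ
Upto ρ m k σ = 1 ≤ k × k ≤ m × σ ≐ ρ k

AllRels : ∀ {A} → ((m : ℕ) → Rel A m) → RelSet A 0ℓ
AllRels ρ k σ = 1 ≤ k × σ ≐ ρ k

Rigid : ∀ {A} → ((m : ℕ) → Rel A m) → Set₁
Rigid {A} ρ = ∀ (g : Perm A) → Aut (AllRels ρ) g → ∀ x → Inverse.to g x ≡ x

UnionKA : ∀ {A} → ((m : ℕ) → Rel A m) → RelSet A (lsuc 0ℓ)
UnionKA ρ k σ = Σ ℕ λ m → 1 ≤ m × KA (Upto ρ m) k σ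

-- Homogeneity makes k-tuples with the same quantifier-free type over ρ₁,…,ρ_m (QfEq m)
-- conjugate under Aut{ρ₁,…,ρ_m}; as there are finitely many such types, every invariant
-- relation is a Boolean combination of atoms. Each formula mentions finitely many ρ_j, so R
-- is the union of these stages, and the result of an invariant operation is invariant under
-- Aut{ρ₁,…,ρ_M} for M beyond the stages of its arguments. Arbitrary intersections need, for
-- each arity k, a level M at which the quantifier-free type of a k-tuple determines its type
-- at all higher levels. Otherwise a path of ever finer types yields a non-isolated type p, and
-- two chain constructions inside A, which realise every one-point extension and hence have
-- limits elementarily equivalent to A by back-and-forth, give countable models of Th(A)
-- omitting and realising p; ω-categoricity forbids this. Finally, rigidity makes every
-- relation Aut R-invariant, whereas R is countable, being defined by an enumeration of
-- formulas; diagonalising along an injective sequence in A gives a unary relation outside R.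

{-# OPTIONS --safe #-}
module Submission where

open import Defs
open import Level using (Level)
open import Axiom.ExcludedMiddle using (ExcludedMiddle)
open import Data.Nat using (ℕ; zero; suc; _≤_; _<_; z≤n; s≤s; _⊔_; _+_; _∸_; _≤′_; ≤′-refl; ≤′-step)
open import Data.Nat.Properties
open import Data.Fin using (Fin; zero; suc; toℕ; fromℕ<)
open import Data.Fin.Properties using (¬Fin0; toℕ-fromℕ<; toℕ<n; toℕ-injective; fromℕ<-toℕ)
open import Data.Product using (Σ; _×_; _,_; proj₁; proj₂)
open import Data.Product.Function.NonDependent.Propositional using (_×-⇔_)
open import Data.Product.Function.Dependent.Propositional using () renaming (congˡ to Σ-congˡ)
open import Data.Sum using (_⊎_; inj₁; inj₂; [_,_]′)
open import Data.Empty using (⊥; ⊥-elim)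
open import Data.Unit using (⊤; tt)
open import Data.List using (List; []; _∷_; _++_; map; cartesianProductWith; allFin; concatMap)
open import Data.List.Membership.Propositional using (_∈_; lose)
open import Data.List.Membership.Propositional.Properties
  using (∈-allFin; ∈-map⁺; ∈-++⁺ˡ; ∈-++⁺ʳ; ∈-concatMap⁺; ∈-cartesianProductWith⁺)
open import Data.List.Relation.Unary.Any using (here; there)
open import Relation.Nullary using (¬_; Dec; yes; no)
open import Relation.Nullary.Decidable using (decidable-stable)
open import Relation.Unary using (_∩_; ∁)
open import Relation.Binary.PropositionalEquality
open import Function.Base using (_∘_; id)
open import Function.Bundles using (_⇔_; mk⇔; Equivalence; _↔_; Inverse; mk↔ₛ′)
open import Function.Properties.Equivalence using ()
  renaming (refl to ⇔-refl; sym to ⇔-sym; trans to ⇔-trans)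
open import Function.Related.TypeIsomorphisms using (¬-cong-⇔)
open import Function.Construct.Identity using (↔-id)
open Equivalence using (to; from)

infixr 5 _⟨⇔⟩_
_⟨⇔⟩_ : ∀ {a b c} {P : Set a} {Q : Set b} {R : Set c} → P ⇔ Q → Q ⇔ R → P ⇔ R
_⟨⇔⟩_ = ⇔-trans

∘-extend : ∀ {B C : Set} {k} (f : B → C) (x : B) (u : Fin k → B) → f ∘ extend x u ≗ extend (f x) (f ∘ u)
∘-extend f x u zero    = refl
∘-extend f x u (suc i) = refl

liftFin : ∀ {a b} → (Fin a → Fin b) → Fin (suc a) → Fin (suc b)
liftFin f zero    = zero
liftFin f (suc i) = suc (f i)

rename : ∀ {S ar a b} → (Fin a → Fin b) → Formula S ar a → Formula S ar b
rename f (atom s v)  = atom s (f ∘ v)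
rename f (equal x y) = equal (f x) (f y)
rename f (neg φ)     = neg (rename f φ)
rename f (and φ ψ)   = and (rename f φ) (rename f ψ)
rename f (ex φ)      = ex (rename (liftFin f) φ)

substitute : ∀ {S ar n} {ar′ : Fin n → ℕ} {k} →
             Formula (Fin n) ar′ k → ((i : Fin n) → Formula S ar (ar′ i)) → Formula S ar k
substitute (atom i v)  ψ = rename v (ψ i)
substitute (equal x y) ψ = equal x y
substitute (neg φ)     ψ = neg (substitute φ ψ)
substitute (and φ φ′)  ψ = and (substitute φ ψ) (substitute φ′ ψ)
substitute (ex φ)      ψ = ex (substitute φ ψ)

Respects≗ : ∀ {B : Set} {k} → Rel B k → Set
Respects≗ σ = ∀ {u v} → u ≗ v → σ u → σ v

module Satisfaction {Sym : Set} {ar : Sym → ℕ} {B : Set} (I : (s : Sym) → Rel B (ar s))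
                    (I-resp : ∀ s → Respects≗ (I s)) where

  extend-cong : ∀ {k} (x : B) {u v : Fin k → B} → u ≗ v → extend x u ≗ extend x v
  extend-cong x e zero    = refl
  extend-cong x e (suc i) = e i

  sat-resp : ∀ {k} (φ : Formula Sym ar k) → Respects≗ (Sat I φ)
  sat-resp (atom s w)  e h        = I-resp s (e ∘ w) h
  sat-resp (equal x y) e h        = trans (sym (e x)) (trans h (e y))
  sat-resp (neg φ)     e h h′     = h (sat-resp φ (sym ∘ e) h′)
  sat-resp (and φ ψ)   e (h , h′) = sat-resp φ e h , sat-resp ψ e h′
  sat-resp (ex φ)      e (x , h)  = x , sat-resp φ (extend-cong x e) h

  module _ (g : B ↔ B) (g-pres : ∀ s u → I s u ⇔ I s (Inverse.to g ∘ u)) where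
    private
      open Inverse g using () renaming (to to g⁺; from to g⁻)
      g⁺g⁻ : ∀ y → g⁺ (g⁻ y) ≡ y
      g⁺g⁻ y = Inverse.inverseˡ g refl
      g⁻g⁺ : ∀ y → g⁻ (g⁺ y) ≡ y
      g⁻g⁺ y = Inverse.inverseʳ g refl

    sat-automorphism : ∀ {k} (φ : Formula Sym ar k) u → Sat I φ u ⇔ Sat I φ (g⁺ ∘ u)
    sat-automorphism (atom s w)  u = g-pres s (u ∘ w)
    sat-automorphism (equal x y) u =
      mk⇔ (cong g⁺) (λ e → trans (sym (g⁻g⁺ (u x))) (trans (cong g⁻ e) (g⁻g⁺ (u y))))
    sat-automorphism (neg φ)     u = ¬-cong-⇔ (sat-automorphism φ u)
    sat-automorphism (and φ ψ)   u = sat-automorphism φ u ×-⇔ sat-automorphism ψ u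
    sat-automorphism (ex φ)      u = mk⇔
      (λ (x , h) → g⁺ x , sat-resp φ (∘-extend g⁺ x u) (to (sat-automorphism φ (extend x u)) h))
      (λ (y , h) → g⁻ y , from (sat-automorphism φ (extend (g⁻ y) u))
                                (sat-resp φ (λ { zero → sym (g⁺g⁻ y) ; (suc i) → refl }) h))

  sat-rename : ∀ {a b} (φ : Formula Sym ar a) (f : Fin a → Fin b) u →
               Sat I (rename f φ) u ⇔ Sat I φ (u ∘ f)
  sat-rename (atom s v)  f u = ⇔-refl
  sat-rename (equal x y) f u = ⇔-refl
  sat-rename (neg φ)     f u = ¬-cong-⇔ (sat-rename φ f u)
  sat-rename (and φ ψ)   f u = sat-rename φ f u ×-⇔ sat-rename ψ f u
  sat-rename (ex φ)      f u = mk⇔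
    (λ (x , h) → x , sat-resp φ extend-lift (to (sat-rename φ (liftFin f) (extend x u)) h))
    (λ (x , h) → x , from (sat-rename φ (liftFin f) (extend x u)) (sat-resp φ (sym ∘ extend-lift) h))
    where
    extend-lift : ∀ {x} → extend x u ∘ liftFin f ≗ extend x (u ∘ f)
    extend-lift zero    = refl
    extend-lift (suc i) = refl

  sat-substitute : ∀ {n} {ar′ : Fin n → ℕ} {k} (φ : Formula (Fin n) ar′ k) (σs : (i : Fin n) → Rel B (ar′ i))
                   (ψ : (i : Fin n) → Formula Sym ar (ar′ i)) → (∀ i → σs i ≐ Sat I (ψ i)) →
                   ∀ u → Sat I (substitute φ ψ) u ⇔ Sat σs φ u
  sat-substitute (atom i v)  σs ψ σs≐ψ u = sat-rename (ψ i) v u ⟨⇔⟩ ⇔-sym (σs≐ψ i (u ∘ v))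
  sat-substitute (equal x y) σs ψ σs≐ψ u = ⇔-refl
  sat-substitute (neg φ)     σs ψ σs≐ψ u = ¬-cong-⇔ (sat-substitute φ σs ψ σs≐ψ u)
  sat-substitute (and φ φ′)  σs ψ σs≐ψ u = sat-substitute φ σs ψ σs≐ψ u ×-⇔ sat-substitute φ′ σs ψ σs≐ψ u
  sat-substitute (ex φ)      σs ψ σs≐ψ u = Σ-congˡ λ {x} → sat-substitute φ σs ψ σs≐ψ (extend x u)

module Coding where

  -- unpair enumerates ℕ × ℕ along the anti-diagonals a + b = d.
  private
    step : ℕ × ℕ → ℕ × ℕ
    step (a , zero)  = (zero , suc a)
    step (a , suc b) = (suc a , b)

  unpair : ℕ → ℕ × ℕ
  unpair zero    = (0 , 0)
  unpair (suc t) = step (unpair t)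

  private
    Hit : ℕ → ℕ → Set
    Hit a b = Σ ℕ λ t → unpair t ≡ (a , b)

    hit-diagonal : ∀ a b → Hit 0 (a + b) → Hit a b
    hit-diagonal zero    b h = h
    hit-diagonal (suc a) b h with hit-diagonal a (suc b) (subst (Hit 0) (sym (+-suc a b)) h)
    ... | t , e = suc t , cong step e

    hit-axis : ∀ d → Hit 0 d
    hit-axis zero = 0 , refl
    hit-axis (suc d) with hit-diagonal d 0 (subst (Hit 0) (sym (+-identityʳ d)) (hit-axis d))
    ... | t , e = suc t , cong step e

  unpair-surjective : ∀ a b → Σ ℕ λ t → unpair t ≡ (a , b)
  unpair-surjective a b = hit-diagonal a b (hit-axis (a + b))

  pair : ℕ → ℕ → ℕ
  pair a b = proj₁ (unpair-surjective a b)

  unpair-pair : ∀ a b → unpair (pair a b) ≡ (a , b)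
  unpair-pair a b = proj₂ (unpair-surjective a b)

  unpair-bound : ∀ t → proj₁ (unpair t) ≤ t × proj₂ (unpair t) ≤ t
  unpair-bound zero = z≤n , z≤n
  unpair-bound (suc t) = step-bound (unpair t) (unpair-bound t)
    where
    step-bound : ∀ p → proj₁ p ≤ t × proj₂ p ≤ t → proj₁ (step p) ≤ suc t × proj₂ (step p) ≤ suc t
    step-bound (a , zero)  (a≤t , _)   = z≤n , s≤s a≤t
    step-bound (a , suc b) (a≤t , b<t) = s≤s a≤t , m≤n⇒m≤1+n (<⇒≤ b<t)

  unpair-recurrent : ∀ x t₀ → Σ ℕ λ t → t₀ ≤ t × proj₁ (unpair t) ≡ x
  unpair-recurrent x t₀ with unpair-surjective x t₀
  ... | t , e = t , subst (λ p → proj₂ p ≤ t) e (proj₂ (unpair-bound t)) , cong proj₁ e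

  decodeFin : (k : ℕ) → ℕ → Fin (suc k)
  decodeFin k       zero    = zero
  decodeFin zero    (suc x) = zero
  decodeFin (suc k) (suc x) = suc (decodeFin k x)

  decodeFin-toℕ : ∀ k (i : Fin (suc k)) → decodeFin k (toℕ i) ≡ i
  decodeFin-toℕ k       zero    = refl
  decodeFin-toℕ (suc k) (suc i) = cong suc (decodeFin-toℕ k i)

  decodeTuple : {X : Set} (d : ℕ → X) (n : ℕ) → ℕ → Fin n → X
  decodeTuple d zero    x ()
  decodeTuple d (suc n) x = extend (d (proj₁ (unpair x))) (decodeTuple d n (proj₂ (unpair x)))

  encodeTuple : {X : Set} (enc : X → ℕ) (n : ℕ) → (Fin n → X) → ℕ
  encodeTuple enc zero    v = 0
  encodeTuple enc (suc n) v = pair (enc (v zero)) (encodeTuple enc n (v ∘ suc))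

  decode-encodeTuple : {X : Set} (d : ℕ → X) (enc : X → ℕ) → (∀ x → d (enc x) ≡ x) →
                       ∀ n (v : Fin n → X) → decodeTuple d n (encodeTuple enc n v) ≗ v
  decode-encodeTuple d enc d∘enc (suc n) v zero
    rewrite unpair-pair (enc (v zero)) (encodeTuple enc n (v ∘ suc)) = d∘enc (v zero)
  decode-encodeTuple d enc d∘enc (suc n) v (suc i)
    rewrite unpair-pair (enc (v zero)) (encodeTuple enc n (v ∘ suc)) =
    decode-encodeTuple d enc d∘enc n (v ∘ suc) i

  max : ∀ n → (Fin n → ℕ) → ℕ
  max zero    f = 0
  max (suc n) f = f zero ⊔ max n (f ∘ suc)

  ≤-max : ∀ n (f : Fin n → ℕ) i → f i ≤ max n f
  ≤-max (suc n) f zero    = m≤m⊔n (f zero) _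
  ≤-max (suc n) f (suc i) = ≤-trans (≤-max n (f ∘ suc) i) (m≤n⊔m (f zero) _)

open Coding

common-bound : (B : ℕ → ℕ → Set) → (∀ q {M M′} → M ≤ M′ → B q M → B q M′) →
               ∀ R → (∀ q → q < R → Σ ℕ (B q)) → Σ ℕ λ M → ∀ q → q < R → B q M
common-bound B mono zero    bounds = 0 , λ q ()
common-bound B mono (suc R) bounds
  with common-bound B mono R (λ q q<R → bounds q (≤-trans q<R (n≤1+n R))) | bounds R ≤-refl
... | M₁ , below | M₂ , at = M₁ ⊔ M₂ , bounded
  where
  bounded : ∀ q → q < suc R → B q (M₁ ⊔ M₂)
  bounded q q<1+R with q <? R
  ... | yes q<R = mono q (m≤m⊔n M₁ M₂) (below q q<R)
  ... | no q≮R with ≤-antisym (≤-pred q<1+R) (≮⇒≥ q≮R)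
  ... | refl = mono q (m≤n⊔m M₁ M₂) at

module Enumeration where

  code : ∀ {k} → Formula ℕ Ar k → ℕ
  code (atom s v)  = pair 0 (pair s (encodeTuple toℕ _ v))
  code (equal x y) = pair 1 (pair (toℕ x) (toℕ y))
  code (neg φ)     = pair 2 (code φ)
  code (and φ ψ)   = pair 3 (pair (code φ) (code ψ))
  code (ex φ)      = pair 4 (code φ)

  depth : ∀ {k} → Formula ℕ Ar k → ℕ
  depth (atom s v)  = 1
  depth (equal x y) = 1
  depth (neg φ)     = suc (depth φ)
  depth (and φ ψ)   = suc (depth φ ⊔ depth ψ)
  depth (ex φ)      = suc (depth φ)

  -- The first argument is fuel; codes that do not come from a formula (and running out of
  -- fuel) decode to the junk formula ∃x. x = x.
  decode : ℕ → (k : ℕ) → ℕ → Formula ℕ Ar k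
  decodeNode : ℕ → ℕ → (k : ℕ) → ℕ → Formula ℕ Ar k
  decode zero    k c = ex (equal zero zero)
  decode (suc f) k c = decodeNode f (proj₁ (unpair c)) k (proj₂ (unpair c))
  decodeNode f 0 (suc k) r = atom (proj₁ (unpair r)) (decodeTuple (decodeFin k) _ (proj₂ (unpair r)))
  decodeNode f 1 (suc k) r = equal (decodeFin k (proj₁ (unpair r))) (decodeFin k (proj₂ (unpair r)))
  decodeNode f 2 k       r = neg (decode f k r)
  decodeNode f 3 k       r = and (decode f k (proj₁ (unpair r))) (decode f k (proj₂ (unpair r)))
  decodeNode f 4 k       r = ex (decode f (suc k) r)
  decodeNode f _ k       r = ex (equal zero zero)

  enumerate : (k : ℕ) → ℕ → Formula ℕ Ar k
  enumerate k t = decode (proj₁ (unpair t)) k (proj₂ (unpair t))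

  module _ {B : Set} (I : (s : ℕ) → Rel B (Ar s)) (I-resp : ∀ s → Respects≗ (I s)) where
    open Satisfaction I I-resp

    Equivalent : ∀ {k} → Formula ℕ Ar k → Formula ℕ Ar k → Set
    Equivalent φ ψ = ∀ u → Sat I φ u ⇔ Sat I ψ u

    decode-code : ∀ {k} (φ : Formula ℕ Ar k) f → depth φ ≤ f → Equivalent (decode f k (code φ)) φ
    decode-code {zero}  (atom s v)  _ _ = ⊥-elim (¬Fin0 (v zero))
    decode-code {suc k} (atom s v) (suc f) _ u
      rewrite unpair-pair 0 (pair s (encodeTuple toℕ _ v)) | unpair-pair s (encodeTuple toℕ _ v) =
      mk⇔ (I-resp s decoded) (I-resp s (sym ∘ decoded))
      where
      decoded : u ∘ decodeTuple (decodeFin k) (suc s) (encodeTuple toℕ (suc s) v) ≗ u ∘ v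
      decoded = cong u ∘ decode-encodeTuple (decodeFin k) toℕ (decodeFin-toℕ k) (suc s) v
    decode-code {suc k} (equal x y) (suc f) _ u
      rewrite unpair-pair 1 (pair (toℕ x) (toℕ y)) | unpair-pair (toℕ x) (toℕ y)
            | decodeFin-toℕ k x | decodeFin-toℕ k y = ⇔-refl
    decode-code (neg φ) (suc f) d≤f u rewrite unpair-pair 2 (code φ) =
      ¬-cong-⇔ (decode-code φ f (≤-pred d≤f) u)
    decode-code (and φ ψ) (suc f) d≤f u
      rewrite unpair-pair 3 (pair (code φ) (code ψ)) | unpair-pair (code φ) (code ψ) =
      decode-code φ f (≤-trans (m≤m⊔n _ _) (≤-pred d≤f)) u
      ×-⇔ decode-code ψ f (≤-trans (m≤n⊔m _ _) (≤-pred d≤f)) u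
    decode-code (ex φ) (suc f) d≤f u rewrite unpair-pair 4 (code φ) =
      Σ-congˡ λ {x} → decode-code φ f (≤-pred d≤f) (extend x u)

    enumerate-complete : ∀ {k} (φ : Formula ℕ Ar k) → Σ ℕ λ t → Equivalent (enumerate k t) φ
    enumerate-complete φ = pair (depth φ) (code φ) , enumerated
      where
      enumerated : Equivalent (enumerate _ (pair (depth φ) (code φ))) φ
      enumerated rewrite unpair-pair (depth φ) (code φ) = decode-code φ (depth φ) ≤-refl

open Enumeration

module Permutations {A : Set} where

  ⟦_⟧ : Perm A → A → A
  ⟦_⟧ = Inverse.to

  ⟦_⟧⁻¹ : Perm A → A → A
  ⟦_⟧⁻¹ = Inverse.from

  ⟦⟧∘⟦⟧⁻¹ : (g : Perm A) → ∀ x → ⟦ g ⟧ (⟦ g ⟧⁻¹ x) ≡ x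
  ⟦⟧∘⟦⟧⁻¹ g x = Inverse.inverseˡ g refl

  ⟦⟧-injective : (g : Perm A) → ∀ {x y} → ⟦ g ⟧ x ≡ ⟦ g ⟧ y → x ≡ y
  ⟦⟧-injective g {x} {y} e = trans (sym (⟦⟧⁻¹∘⟦⟧ x)) (trans (cong ⟦ g ⟧⁻¹ e) (⟦⟧⁻¹∘⟦⟧ y))
    where
    ⟦⟧⁻¹∘⟦⟧ : ∀ x → ⟦ g ⟧⁻¹ (⟦ g ⟧ x) ≡ x
    ⟦⟧⁻¹∘⟦⟧ x = Inverse.inverseʳ g refl

  image-cong : ∀ {k} (g : Perm A) {σ τ : Rel A k} → σ ≐ τ → image g σ ≐ image g τ
  image-cong g e b = mk⇔ (λ (a , h , x) → a , to (e a) h , x) (λ (a , h , x) → a , from (e a) h , x)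

  module _ {k} {σ : Rel A k} (g : Perm A) (inv : image g σ ≐ σ) where

    invariant⇒respects≗ : Respects≗ σ
    invariant⇒respects≗ {u} {v} e h with from (inv u) h
    ... | a , ha , ea = to (inv v) (a , ha , λ i → trans (sym (e i)) (ea i))

    invariant⇒pointwise : ∀ u → σ u ⇔ σ (⟦ g ⟧ ∘ u)
    invariant⇒pointwise u = mk⇔ (λ h → to (inv (⟦ g ⟧ ∘ u)) (u , h , λ i → refl)) pull
      where
      pull : σ (⟦ g ⟧ ∘ u) → σ u
      pull h with from (inv (⟦ g ⟧ ∘ u)) h
      ... | a , ha , ea = invariant⇒respects≗ (λ i → sym (⟦⟧-injective g (ea i))) ha

  pointwise⇒invariant : ∀ {k} (g : Perm A) {τ : Rel A k} → Respects≗ τ →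
                        (∀ u → τ u ⇔ τ (⟦ g ⟧ ∘ u)) → image g τ ≐ τ
  pointwise⇒invariant g {τ} resp pt b = mk⇔
    (λ (a , h , e) → resp (sym ∘ e) (to (pt a) h))
    (λ h → ⟦ g ⟧⁻¹ ∘ b , from (pt _) (resp (sym ∘ ⟦⟧∘⟦⟧⁻¹ g ∘ b) h) , sym ∘ ⟦⟧∘⟦⟧⁻¹ g ∘ b)

open Permutations

module LogicalClosure {A : Set} where

  KA-mono : ∀ {ℓ ℓ′} {Q : RelSet A ℓ} {Q′ : RelSet A ℓ′} → (∀ k σ → Q k σ → Q′ k σ) →
            ∀ {k σ} → KA Q k σ → KA Q′ k σ
  KA-mono Q⊆Q′ (base q)                  = base (Q⊆Q′ _ _ q)
  KA-mono Q⊆Q′ (logical ar σs ch p φ e) = logical ar σs (KA-mono Q⊆Q′ ∘ ch) p φ e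

  logical-invariant : ∀ {n} {ar : Fin n → ℕ} {k} (g : Perm A) (σs : (i : Fin n) → Rel A (ar i)) →
                      (∀ i → image g (σs i) ≐ σs i) → (φ : Formula (Fin n) ar k) →
                      ∀ {τ : Rel A k} → τ ≐ L φ σs → image g τ ≐ τ
  logical-invariant g σs inv φ {τ} e =
    pointwise⇒invariant g (λ u≗v h → from (e _) (sat-resp φ u≗v (to (e _) h)))
      (λ u → e u ⟨⇔⟩ sat-automorphism g (λ i → invariant⇒pointwise g (inv i)) φ u ⟨⇔⟩ ⇔-sym (e _))
    where open Satisfaction σs (λ i → invariant⇒respects≗ g (inv i))

  KA⊆sInvAut : ∀ {ℓ} {Q : RelSet A ℓ} {k σ} → KA Q k σ → ∀ g → Aut Q g → image g σ ≐ σ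
  KA⊆sInvAut (base q)                  g aut = aut _ _ q
  KA⊆sInvAut (logical ar σs ch p φ e) g aut =
    logical-invariant g σs (λ i → KA⊆sInvAut (ch i) g aut) φ e

  KA-respects≗ : ∀ {ℓ} {Q : RelSet A ℓ} → (∀ k σ → Q k σ → Respects≗ σ) → ∀ {k σ} → KA Q k σ → Respects≗ σ
  KA-respects≗ Q-resp (base q) = Q-resp _ _ q
  KA-respects≗ Q-resp (logical ar σs ch p φ e) u≗v h =
    from (e _) (sat-resp φ u≗v (to (e _) h))
    where open Satisfaction σs (λ i → KA-respects≗ Q-resp (ch i))

open LogicalClosure

module Classical (lem : (ℓ : Level) → ExcludedMiddle ℓ) where

  dec : ∀ {ℓ} (P : Set ℓ) → Dec P
  dec P = lem _

  pick : {X : Set} (P : X → Set) → X → X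
  pick P x₀ with dec (Σ _ P)
  ... | yes (x , _) = x
  ... | no _        = x₀

  pick-satisfies : {X : Set} (P : X → Set) (x₀ : X) → Σ X P → P (pick P x₀)
  pick-satisfies P x₀ w with dec (Σ _ P)
  ... | yes (x , p) = p
  ... | no ¬w       = ⊥-elim (¬w w)

  module FiniteClasses {X At : Set} (sem : At → X → Set) where

    Agree : List At → X → X → Set
    Agree l x y = ∀ α → α ∈ l → sem α x ⇔ sem α y

    Agree-sym : ∀ {l x y} → Agree l x y → Agree l y x
    Agree-sym ag α m = ⇔-sym (ag α m)

    Agree-trans : ∀ {l x y z} → Agree l x y → Agree l y z → Agree l x z
    Agree-trans ag ag′ α m = ag α m ⟨⇔⟩ ag′ α m

    Agree-∷ : ∀ {α l x y} → (sem α x ⇔ sem α y) → Agree l x y → Agree (α ∷ l) x y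
    Agree-∷ e ag β (here refl) = e
    Agree-∷ e ag β (there m)   = ag β m

    Agree-tail : ∀ {α l x y} → Agree (α ∷ l) x y → Agree l x y
    Agree-tail ag β m = ag β (there m)

    FinitelyManyClasses : List At → Set
    FinitelyManyClasses l =
      Σ ℕ λ R → Σ (ℕ → X) λ rep → ∀ x → Σ ℕ λ q → q < R × Agree l x (rep q)

    refine : ∀ α {l} → FinitelyManyClasses l → FinitelyManyClasses (α ∷ l)
    refine α {l} (R , rep , cover) = R + R , rep′ , cover′
      where
      Class : ℕ → (X → Set) → X → Set
      Class q S y = Agree l y (rep q) × S y

      representative : (X → Set) → ℕ → X
      representative S q = pick (Class q S) (rep q)

      representative-agrees : ∀ {S x q} → Agree l x (rep q) → S x → (∀ {y} → S x → S y → sem α x ⇔ sem α y) →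
                              Agree (α ∷ l) x (representative S q)
      representative-agrees {S} {x} {q} ag s same =
        let (ag′ , s′) = pick-satisfies (Class q S) (rep q) (x , ag , s)
        in Agree-∷ (same s s′) (Agree-trans ag (Agree-sym ag′))

      rep′ : ℕ → X
      rep′ q with q <? R
      ... | yes _ = representative (sem α) q
      ... | no _  = representative (∁ (sem α)) (q ∸ R)

      rep′-low : ∀ {q} → q < R → rep′ q ≡ representative (sem α) q
      rep′-low {q} q<R with q <? R
      ... | yes _   = refl
      ... | no q≮R = ⊥-elim (q≮R q<R)

      rep′-high : ∀ q → rep′ (R + q) ≡ representative (∁ (sem α)) q
      rep′-high q with R + q <? R
      ... | yes R+q<R = ⊥-elim (<-irrefl refl (≤-<-trans (m≤m+n R q) R+q<R))
      ... | no _      = cong (representative (∁ (sem α))) (m+n∸m≡n R q)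

      cover′ : ∀ x → Σ ℕ λ q → q < R + R × Agree (α ∷ l) x (rep′ q)
      cover′ x with cover x | dec (sem α x)
      ... | q , q<R , ag | yes s =
        q , ≤-trans q<R (m≤m+n R R) ,
        subst (Agree (α ∷ l) x) (sym (rep′-low q<R))
              (representative-agrees ag s λ s s′ → mk⇔ (λ _ → s′) (λ _ → s))
      ... | q , q<R , ag | no ¬s =
        R + q , +-monoʳ-< R q<R ,
        subst (Agree (α ∷ l) x) (sym (rep′-high q))
              (representative-agrees ag ¬s λ ¬s ¬s′ → mk⇔ (⊥-elim ∘ ¬s) (⊥-elim ∘ ¬s′))

    finitely-many-classes : X → ∀ l → FinitelyManyClasses l
    finitely-many-classes x₀ []      = 1 , (λ _ → x₀) , λ x → 0 , s≤s z≤n , λ α ()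
    finitely-many-classes x₀ (α ∷ l) = refine α (finitely-many-classes x₀ l)

  ite : ∀ {S ar k} → Formula S ar k → Formula S ar k → Formula S ar k → Formula S ar k
  ite φ ψ χ = neg (and (neg (and φ ψ)) (neg (and (neg φ) χ)))

  module _ {S : Set} {ar : S → ℕ} {B : Set} (I : (s : S) → Rel B (ar s))
           {k} (φ ψ χ : Formula S ar k) (b : Fin k → B) where

    sat-ite-true : Sat I φ b → Sat I (ite φ ψ χ) b ⇔ Sat I ψ b
    sat-ite-true s = mk⇔ then (λ t (¬φψ , _) → ¬φψ (s , t))
      where
      then : Sat I (ite φ ψ χ) b → Sat I ψ b
      then h with dec (Sat I ψ b)
      ... | yes t  = t
      ... | no ¬t = ⊥-elim (h ((λ (_ , t) → ¬t t) , (λ (¬s , _) → ¬s s)))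

    sat-ite-false : ¬ Sat I φ b → Sat I (ite φ ψ χ) b ⇔ Sat I χ b
    sat-ite-false ¬s = mk⇔ else (λ t (_ , ¬¬φχ) → ¬¬φχ (¬s , t))
      where
      else : Sat I (ite φ ψ χ) b → Sat I χ b
      else h with dec (Sat I χ b)
      ... | yes t  = t
      ... | no ¬t = ⊥-elim (h ((λ (s , _) → ¬s s) , (λ (_ , t) → ¬t t)))

  -- tree l C branches on the atoms of l; a leaf is true iff some σ-tuple in C reaches it.
  module DecisionTree {S : Set} {ar : S → ℕ} {B : Set} (I : (s : S) → Rel B (ar s))
                      {k : ℕ} (σ : Rel B (suc k)) where
    open FiniteClasses (λ (φ : Formula S ar (suc k)) → Sat I φ)

    Witnessed : List (Formula S ar (suc k)) → Rel B (suc k) → Rel B (suc k)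
    Witnessed l C b = Σ (Fin (suc k) → B) λ a → C a × σ a × Agree l a b

    tree : List (Formula S ar (suc k)) → Rel B (suc k) → Formula S ar (suc k)
    tree [] C with dec (Σ (Fin (suc k) → B) λ a → C a × σ a)
    ... | yes _ = equal zero zero
    ... | no _  = neg (equal zero zero)
    tree (φ ∷ l) C = ite φ (tree l (C ∩ Sat I φ)) (tree l (C ∩ ∁ (Sat I φ)))

    witnessed-∷ : ∀ {φ l C b} (D : Rel B (suc k)) → (∀ a → D a ⇔ (Sat I φ a ⇔ Sat I φ b)) →
                  Witnessed l (C ∩ D) b ⇔ Witnessed (φ ∷ l) C b
    witnessed-∷ D D⇔ = mk⇔
      (λ (a , (ca , da) , sa , ag) → a , ca , sa , Agree-∷ (to (D⇔ a) da) ag)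
      (λ (a , ca , sa , ag) → a , (ca , from (D⇔ a) (ag _ (here refl))) , sa , Agree-tail ag)

    sat-tree : ∀ l C b → C b → Sat I (tree l C) b ⇔ Witnessed l C b
    sat-tree [] C b cb with dec (Σ (Fin (suc k) → B) λ a → C a × σ a)
    ... | yes (a , ca , sa) = mk⇔ (λ _ → a , ca , sa , λ _ ()) (λ _ → refl)
    ... | no ¬w             = mk⇔ (λ h → ⊥-elim (h refl)) (λ (a , ca , sa , _) → ⊥-elim (¬w (a , ca , sa)))
    sat-tree (φ ∷ l) C b cb with dec (Sat I φ b)
    ... | yes s = sat-ite-true I φ (tree l (C ∩ Sat I φ)) (tree l (C ∩ ∁ (Sat I φ))) b s
                  ⟨⇔⟩ sat-tree l _ b (cb , s)
                  ⟨⇔⟩ witnessed-∷ (Sat I φ) (λ a → mk⇔ (λ sa → mk⇔ (λ _ → s) (λ _ → sa)) (λ e → from e s))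
    ... | no ¬s = sat-ite-false I φ (tree l (C ∩ Sat I φ)) (tree l (C ∩ ∁ (Sat I φ))) b ¬s
                  ⟨⇔⟩ sat-tree l _ b (cb , ¬s)
                  ⟨⇔⟩ witnessed-∷ (∁ (Sat I φ))
                        (λ a → mk⇔ (λ ¬sa → mk⇔ (⊥-elim ∘ ¬sa) (⊥-elim ∘ ¬s)) (λ e → ¬s ∘ to e))

  module InfiniteSet {A : Set} (infinite : Infinite A) where

    InjectiveBelow : ℕ → (ℕ → A) → Set
    InjectiveBelow n c = ∀ i j → i < n → j < n → c i ≡ c j → i ≡ j

    InjectiveBelow-mono : ∀ {n n′ c} → n′ ≤ n → InjectiveBelow n c → InjectiveBelow n′ c
    InjectiveBelow-mono n′≤n inj i j i<n′ j<n′ = inj i j (≤-trans i<n′ n′≤n) (≤-trans j<n′ n′≤n)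

    some-element : A
    some-element with dec A
    ... | yes a  = a
    ... | no ¬a = ⊥-elim (infinite (0 , mk↔ₛ′ (⊥-elim ∘ ¬a) (λ ()) (λ ()) (⊥-elim ∘ ¬a)))

    Fresh : ℕ → (ℕ → A) → A → Set
    Fresh n c y = ∀ i → i < n → c i ≢ y

    -- Otherwise c would enumerate A by Fin n.
    fresh : ∀ n (c : ℕ → A) → InjectiveBelow n c → Σ A (Fresh n c)
    fresh n c inj with dec (Σ A (Fresh n c))
    ... | yes y = y
    ... | no ¬y = ⊥-elim (infinite (n , mk↔ₛ′ index (c ∘ toℕ) index-c c-index))
      where
      find : ∀ a → Σ (Fin n) λ i → c (toℕ i) ≡ a
      find a with dec (Σ (Fin n) λ i → c (toℕ i) ≡ a)
      ... | yes h = h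
      ... | no ¬h = ⊥-elim (¬y (a , λ i i<n e → ¬h (fromℕ< i<n , trans (cong c (toℕ-fromℕ< i<n)) e)))
      index : A → Fin n
      index a = proj₁ (find a)
      index-c : ∀ i → index (c (toℕ i)) ≡ i
      index-c i = toℕ-injective (inj _ _ (toℕ<n _) (toℕ<n i) (proj₂ (find (c (toℕ i)))))
      c-index : ∀ a → c (toℕ (index a)) ≡ a
      c-index a = proj₂ (find a)

    abstract
      update : ℕ → A → (ℕ → A) → ℕ → A
      update n y c i with i ≟ n
      ... | yes _ = y
      ... | no _  = c i

      update-< : ∀ {n y c i} → i < n → update n y c i ≡ c i
      update-< {n} {y} {c} {i} i<n with i ≟ n
      ... | yes refl = ⊥-elim (<-irrefl refl i<n)
      ... | no _     = refl

      update-≡ : ∀ {n y c} → update n y c n ≡ y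
      update-≡ {n} with n ≟ n
      ... | yes _  = refl
      ... | no n≢n = ⊥-elim (n≢n refl)

      update-injective : ∀ {n y c} → InjectiveBelow n c → Fresh n c y → InjectiveBelow (suc n) (update n y c)
      update-injective {n} {y} {c} inj fr i j i<1+n j<1+n e with i ≟ n | j ≟ n
      ... | yes i≡n | yes j≡n = trans i≡n (sym j≡n)
      ... | yes _   | no j≢n  = ⊥-elim (fr j (≤∧≢⇒< (≤-pred j<1+n) j≢n) (sym e))
      ... | no i≢n  | yes _   = ⊥-elim (fr i (≤∧≢⇒< (≤-pred i<1+n) i≢n) e)
      ... | no i≢n  | no j≢n  = inj i j (≤∧≢⇒< (≤-pred i<1+n) i≢n) (≤∧≢⇒< (≤-pred j<1+n) j≢n) e

    private
      initial-segments : (n : ℕ) → Σ (ℕ → A) (InjectiveBelow n)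
      initial-segments zero = (λ _ → some-element) , λ i j ()
      initial-segments (suc n) with initial-segments n
      ... | c , inj with fresh n c inj
      ... | y , fr = update n y c , update-injective inj fr

    injection : ℕ → A
    injection i = proj₁ (initial-segments (suc i)) i

    private
      initial-segments-stable : ∀ i n → i < n → proj₁ (initial-segments n) i ≡ injection i
      initial-segments-stable i (suc n) i<1+n with i <? n
      ... | yes i<n = trans (update-< i<n) (initial-segments-stable i n i<n)
      ... | no i≮n with ≤-antisym (≤-pred i<1+n) (≮⇒≥ i≮n)
      ... | refl = refl

    injection-injective : ∀ {i j} → injection i ≡ injection j → i ≡ j
    injection-injective {i} {j} e =
      proj₂ (initial-segments N) i j i<N j<N
        (trans (initial-segments-stable i N i<N) (trans e (sym (initial-segments-stable j N j<N))))
      where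
      N = suc (i ⊔ j)
      i<N : i < N
      i<N = s≤s (m≤m⊔n i j)
      j<N : j < N
      j<N = s≤s (m≤n⊔m i j)


module Structure (lem : (ℓ : Level) → ExcludedMiddle ℓ) (A : Set) (ρ : (m : ℕ) → Rel A m)
                 (hom : (m : ℕ) → 1 ≤ m → Homogeneous (Upto ρ m)) where
  open Classical lem

  Upto-mono : ∀ {m m′} → m ≤ m′ → ∀ k σ → Upto ρ m k σ → Upto ρ m′ k σ
  Upto-mono m≤m′ k σ (1≤k , k≤m , e) = 1≤k , ≤-trans k≤m m≤m′ , e

  Aut-antitone : ∀ {m m′} → m ≤ m′ → ∀ g → Aut (Upto ρ m′) g → Aut (Upto ρ m) g
  Aut-antitone m≤m′ g aut k σ u = aut k σ (Upto-mono m≤m′ k σ u)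

  ρ∈Upto : ∀ {j m} → 1 ≤ j → j ≤ m → Upto ρ m j (ρ j)
  ρ∈Upto 1≤j j≤m = 1≤j , j≤m , λ _ → ⇔-refl

  -- Homogeneity for the empty tuple provides a permutation fixing ρ j, and every relation
  -- fixed by some permutation respects ≗.
  ρ-respects≗ : ∀ j → 1 ≤ j → Respects≗ (ρ j)
  ρ-respects≗ j 1≤j
    with hom j 1≤j 0 (λ ()) (λ ()) ((λ ()) , (λ ()) , λ { (suc k) σ _ f → ⊥-elim (¬Fin0 (f zero)) })
  ... | g , aut , _ = invariant⇒respects≗ g (aut j (ρ j) (ρ∈Upto 1≤j ≤-refl))

  ρ-resp-⇔ : ∀ j → 1 ≤ j → ∀ {u v} → u ≗ v → ρ j u ⇔ ρ j v
  ρ-resp-⇔ j 1≤j e = mk⇔ (ρ-respects≗ j 1≤j e) (ρ-respects≗ j 1≤j (sym ∘ e))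

  aut-pointwise : ∀ {m} (g : Perm A) → Aut (Upto ρ m) g → ∀ j → 1 ≤ j → j ≤ m →
                  ∀ u → ρ j u ⇔ ρ j (⟦ g ⟧ ∘ u)
  aut-pointwise g aut j 1≤j j≤m = invariant⇒pointwise g (aut j (ρ j) (ρ∈Upto 1≤j j≤m))

  QfEq : ∀ {r} → ℕ → (Fin r → A) → (Fin r → A) → Set
  QfEq {r} L a b = (∀ i i′ → (a i ≡ a i′) ⇔ (b i ≡ b i′)) ×
                   (∀ j → 1 ≤ j → j ≤ L → (f : Fin j → Fin r) → ρ j (a ∘ f) ⇔ ρ j (b ∘ f))

  module _ {r : ℕ} where

    QfEq-refl : ∀ {L} {a : Fin r → A} → QfEq L a a
    QfEq-refl = (λ i i′ → ⇔-refl) , (λ j _ _ f → ⇔-refl)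

    QfEq-sym : ∀ {L} {a b : Fin r → A} → QfEq L a b → QfEq L b a
    QfEq-sym (e , h) = (λ i i′ → ⇔-sym (e i i′)) , (λ j p q f → ⇔-sym (h j p q f))

    QfEq-trans : ∀ {L} {a b c : Fin r → A} → QfEq L a b → QfEq L b c → QfEq L a c
    QfEq-trans (e , h) (e′ , h′) = (λ i i′ → e i i′ ⟨⇔⟩ e′ i i′) , (λ j p q f → h j p q f ⟨⇔⟩ h′ j p q f)

    QfEq-mono : ∀ {L L′} {a b : Fin r → A} → L′ ≤ L → QfEq L a b → QfEq L′ a b
    QfEq-mono L′≤L (e , h) = e , (λ j p q f → h j p (≤-trans q L′≤L) f)

    QfEq-resp : ∀ {L} {a a′ b b′ : Fin r → A} → a ≗ a′ → b ≗ b′ → QfEq L a b → QfEq L a′ b′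
    QfEq-resp {a = a} {a′} {b} {b′} a≗a′ b≗b′ (e , h) =
      (λ i i′ → ≡-resp a≗a′ i i′ ⟨⇔⟩ e i i′ ⟨⇔⟩ ⇔-sym (≡-resp b≗b′ i i′)) ,
      (λ j p q f → ρ-resp-⇔ j p (sym ∘ a≗a′ ∘ f) ⟨⇔⟩ h j p q f ⟨⇔⟩ ρ-resp-⇔ j p (b≗b′ ∘ f))
      where
      ≡-resp : ∀ {c c′ : Fin r → A} → c ≗ c′ → ∀ i i′ → (c′ i ≡ c′ i′) ⇔ (c i ≡ c i′)
      ≡-resp c≗c′ i i′ = mk⇔ (λ x → trans (c≗c′ i) (trans x (sym (c≗c′ i′))))
                             (λ x → trans (sym (c≗c′ i)) (trans x (c≗c′ i′)))

    QfEq-aut : ∀ {L M} (g : Perm A) → Aut (Upto ρ M) g → L ≤ M → (a : Fin r → A) → QfEq L a (⟦ g ⟧ ∘ a)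
    QfEq-aut g aut L≤M a =
      (λ i i′ → mk⇔ (cong ⟦ g ⟧) (⟦⟧-injective g)) ,
      (λ j p q f → aut-pointwise g aut j p (≤-trans q L≤M) (a ∘ f))

  QfEq-∘ : ∀ {r r′ L} {a b : Fin r → A} (f : Fin r′ → Fin r) → QfEq L a b → QfEq L (a ∘ f) (b ∘ f)
  QfEq-∘ f (e , h) = (λ i i′ → e (f i) (f i′)) , (λ j p q f′ → h j p q (f ∘ f′))

  QfEq-empty : ∀ {L} {a b : Fin 0 → A} → QfEq L a b
  QfEq-empty = (λ ()) , λ { (suc j) _ _ f → ⊥-elim (¬Fin0 (f zero)) }

  QfEq-injective : ∀ {k L} {a b : Fin k → A} → QfEq L a b → Injective a → Injective b
  QfEq-injective (e , _) a-inj i j bi≡bj = a-inj i j (from (e i j) bi≡bj)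

  record Deduplication {r} (a : Fin r → A) : Set where
    field
      size      : ℕ
      size≤     : size ≤ r
      embed     : Fin size → Fin r
      index     : Fin r → Fin size
      a-embed   : ∀ i → a (embed (index i)) ≡ a i
      injective : Injective (a ∘ embed)

  deduplicate : ∀ {r} (a : Fin r → A) → Deduplication a
  deduplicate {zero} a = record
    { size = 0 ; size≤ = z≤n ; embed = λ () ; index = λ () ; a-embed = λ () ; injective = λ () }
  deduplicate {suc r} a with deduplicate (a ∘ suc) | dec (Σ (Fin r) λ i → a (suc i) ≡ a zero)
  ... | D | yes (i , a₁+i≡a₀) = record
    { size      = size
    ; size≤     = m≤n⇒m≤1+n size≤
    ; embed     = suc ∘ embed
    ; index     = λ { zero → index i ; (suc x) → index x }
    ; a-embed   = λ { zero → trans (a-embed i) a₁+i≡a₀ ; (suc x) → a-embed x }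
    ; injective = injective
    }
    where open Deduplication D
  ... | D | no ¬dup = record
    { size      = suc size
    ; size≤     = s≤s size≤
    ; embed     = λ { zero → zero ; (suc x) → suc (embed x) }
    ; index     = λ { zero → zero ; (suc x) → suc (index x) }
    ; a-embed   = λ { zero → refl ; (suc x) → a-embed x }
    ; injective = injective′
    }
    where
    open Deduplication D
    injective′ : Injective _
    injective′ zero    zero    _ = refl
    injective′ zero    (suc y) e = ⊥-elim (¬dup (embed y , sym e))
    injective′ (suc x) zero    e = ⊥-elim (¬dup (embed x , e))
    injective′ (suc x) (suc y) e = cong suc (injective x y e)

  qfEq⇒aut : ∀ {r L} {a b : Fin r → A} → 1 ≤ L → QfEq L a b →
             Σ (Perm A) λ g → Aut (Upto ρ L) g × (∀ i → ⟦ g ⟧ (a i) ≡ b i)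
  qfEq⇒aut {r} {L} {a} {b} 1≤L (e , h) with hom L 1≤L size (a ∘ embed) (b ∘ embed) partial
    where
    open Deduplication (deduplicate a)
    partial : PartialAut (Upto ρ L) (a ∘ embed) (b ∘ embed)
    partial = injective ,
              (λ x y bx≡by → injective x y (from (e (embed x) (embed y)) bx≡by)) ,
              (λ { k σ (1≤k , k≤L , σ≐ρ) f → σ≐ρ _ ⟨⇔⟩ h k 1≤k k≤L (embed ∘ f) ⟨⇔⟩ ⇔-sym (σ≐ρ _) })
  ... | g , aut , g-maps = g , aut , λ i →
    trans (cong ⟦ g ⟧ (sym (a-embed i)))
          (trans (g-maps (index i)) (to (e (embed (index i)) i) (a-embed i)))
    where open Deduplication (deduplicate a)

  -- Definability over ρ₁,…,ρ_m

  arity≤ : ∀ {L} → Fin L → ℕ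
  arity≤ i = suc (toℕ i)

  ρ≤ : ∀ L → (i : Fin L) → Rel A (arity≤ i)
  ρ≤ L i = ρ (suc (toℕ i))

  ρ≤∈Upto : ∀ L (i : Fin L) → Upto ρ L (arity≤ i) (ρ≤ L i)
  ρ≤∈Upto L i = ρ∈Upto (s≤s z≤n) (toℕ<n i)

  allMaps : (j r : ℕ) → List (Fin j → Fin r)
  allMaps zero    r = (λ ()) ∷ []
  allMaps (suc j) r = cartesianProductWith extend (allFin r) (allMaps j r)

  allMaps-complete : ∀ j r (f : Fin j → Fin r) → Σ (Fin j → Fin r) λ f′ → f′ ∈ allMaps j r × f′ ≗ f
  allMaps-complete zero r f = (λ ()) , here refl , λ ()
  allMaps-complete (suc j) r f with allMaps-complete j r (f ∘ suc)
  ... | f′ , f′∈ , f′≗ = extend (f zero) f′ ,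
                         ∈-cartesianProductWith⁺ extend (∈-allFin (f zero)) f′∈ ,
                         λ { zero → refl ; (suc x) → f′≗ x }

  equalityAtoms : ∀ {L} r → List (Formula (Fin L) arity≤ r)
  equalityAtoms r = cartesianProductWith equal (allFin r) (allFin r)

  relationAtoms : ∀ L r → List (Formula (Fin L) arity≤ r)
  relationAtoms L r = concatMap (λ i → map (atom i) (allMaps (arity≤ i) r)) (allFin L)

  atoms : ∀ L r → List (Formula (Fin L) arity≤ r)
  atoms L r = equalityAtoms r ++ relationAtoms L r

  open module AtomClasses {L r : ℕ} =
    FiniteClasses (λ (φ : Formula (Fin L) arity≤ r) → Sat (ρ≤ L) φ) using (Agree)

  agree-atoms⇒QfEq : ∀ L {r} {a b : Fin r → A} → Agree (atoms L r) a b → QfEq L a b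
  agree-atoms⇒QfEq L {r} {a} {b} ag = equalities , relations
    where
    equalities : ∀ i i′ → (a i ≡ a i′) ⇔ (b i ≡ b i′)
    equalities i i′ =
      ag (equal i i′) (∈-++⁺ˡ (∈-cartesianProductWith⁺ equal (∈-allFin i) (∈-allFin i′)))
    relation : (i : Fin L) (f : Fin (arity≤ i) → Fin r) → ρ≤ L i (a ∘ f) ⇔ ρ≤ L i (b ∘ f)
    relation i f with allMaps-complete (arity≤ i) r f
    ... | f′ , f′∈ , f′≗ =
      ρ-resp-⇔ _ (s≤s z≤n) (cong a ∘ sym ∘ f′≗)
      ⟨⇔⟩ ag (atom i f′) (∈-++⁺ʳ (equalityAtoms r)
                            (∈-concatMap⁺ (λ i → map (atom i) (allMaps (arity≤ i) r))
                                          (lose (∈-allFin i) (∈-map⁺ (atom i) f′∈))))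
      ⟨⇔⟩ ρ-resp-⇔ _ (s≤s z≤n) (cong b ∘ f′≗)
    relations : ∀ j → 1 ≤ j → j ≤ L → (f : Fin j → Fin r) → ρ j (a ∘ f) ⇔ ρ j (b ∘ f)
    relations (suc j) _ j<L with relation (fromℕ< j<L)
    ... | h rewrite toℕ-fromℕ< j<L = h

  abstract
    finitely-many-qfTypes : ∀ L r → (Fin r → A) →
                            Σ ℕ λ R → Σ (ℕ → (Fin r → A)) λ rep → ∀ x → Σ ℕ λ q → q < R × QfEq L x (rep q)
    finitely-many-qfTypes L r x₀ with FiniteClasses.finitely-many-classes (λ φ → Sat (ρ≤ L) φ) x₀ (atoms L r)
    ... | R , rep , cover = R , rep , λ x → let (q , q<R , ag) = cover x in q , q<R , agree-atoms⇒QfEq L ag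

  -- Homogeneity puts tuples that agree on all atoms in one orbit, so the decision tree over
  -- the atoms of ρ₁,…,ρ_m defines every invariant relation.
  sInvAut⊆KA : ∀ m → 1 ≤ m → ∀ {k σ} → sInv (Aut (Upto ρ m)) k σ → KA (Upto ρ m) k σ
  sInvAut⊆KA m 1≤m {suc k} {σ} (_ , inv) =
    logical arity≤ (ρ≤ m) (λ i → base (ρ≤∈Upto m i)) (s≤s z≤n) φ σ≐φ
    where
    open DecisionTree (ρ≤ m) σ
    φ = tree (atoms m (suc k)) (λ _ → ⊤)
    φ⇔witnessed : ∀ b → Sat (ρ≤ m) φ b ⇔ Witnessed (atoms m (suc k)) (λ _ → ⊤) b
    φ⇔witnessed b = sat-tree (atoms m (suc k)) (λ _ → ⊤) b tt
    witnessed⇒σ : ∀ {b} → Witnessed (atoms m (suc k)) (λ _ → ⊤) b → σ b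
    witnessed⇒σ (a , _ , σa , ag) with qfEq⇒aut 1≤m (agree-atoms⇒QfEq m ag)
    ... | g , aut , g-maps =
      invariant⇒respects≗ g (inv g aut) g-maps (to (invariant⇒pointwise g (inv g aut) a) σa)
    σ≐φ : σ ≐ L φ (ρ≤ m)
    σ≐φ b = mk⇔ (λ σb → from (φ⇔witnessed b) (b , tt , σb , λ _ _ → ⇔-refl))
                (witnessed⇒σ ∘ to (φ⇔witnessed b))

  KA-Upto≈sInvAut : ∀ m → 1 ≤ m → KA (Upto ρ m) ≈ₛ sInv (Aut (Upto ρ m))
  KA-Upto≈sInvAut m 1≤m k 1≤k σ =
    mk⇔ (λ h → 1≤k , λ g aut → KA⊆sInvAut h g aut) (sInvAut⊆KA m 1≤m)

  -- Closure properties of R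

  AllRels-respects≗ : ∀ k σ → AllRels ρ k σ → Respects≗ σ
  AllRels-respects≗ k σ (1≤k , σ≐ρ) e h = from (σ≐ρ _) (ρ-respects≗ k 1≤k e (to (σ≐ρ _) h))

  common-stage : ∀ {n} {ms : Fin n → ℕ} {σs : (i : Fin n) → Rel A (ms i)} →
                 (∀ i → UnionKA ρ (ms i) (σs i)) → Σ ℕ λ M → 1 ≤ M × (∀ i → KA (Upto ρ M) (ms i) (σs i))
  common-stage {n} u = suc M , s≤s z≤n , λ i →
    KA-mono (Upto-mono (≤-trans (≤-max n stage i) (n≤1+n M))) (proj₂ (proj₂ (u i)))
    where
    stage : Fin n → ℕ
    stage i = proj₁ (u i)
    M = max n stage

  KA-AllRels⇒Union : ∀ {k σ} → KA (AllRels ρ) k σ → UnionKA ρ k σ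
  KA-AllRels⇒Union (base (1≤k , σ≐ρ)) = _ , 1≤k , base (1≤k , ≤-refl , σ≐ρ)
  KA-AllRels⇒Union (logical ar σs ch 1≤k φ e) with common-stage (λ i → KA-AllRels⇒Union (ch i))
  ... | M , 1≤M , stage = M , 1≤M , logical ar σs stage 1≤k φ e

  Union⇒KA-AllRels : ∀ {k σ} → UnionKA ρ k σ → KA (AllRels ρ) k σ
  Union⇒KA-AllRels (m , _ , h) = KA-mono (λ k σ (1≤k , _ , σ≐ρ) → 1≤k , σ≐ρ) h

  KA-AllRels≈Union : KA (AllRels ρ) ≈ₛ UnionKA ρ
  KA-AllRels≈Union k 1≤k σ = mk⇔ KA-AllRels⇒Union Union⇒KA-AllRels

  KA-AllRels⊆sInvAut : KA (AllRels ρ) ⊆ₛ sInv (Aut (KA (AllRels ρ)))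
  KA-AllRels⊆sInvAut k 1≤k σ h = 1≤k , λ g aut → aut k σ h

  KA-full : ∀ {k} → 1 ≤ k → ∀ {τ : Rel A k} → (∀ a → τ a) → KA (AllRels ρ) k τ
  KA-full {suc k} 1≤k τ-full =
    logical {n = 0} (λ ()) (λ ()) (λ ()) 1≤k (equal zero zero) (λ a → mk⇔ (λ _ → refl) (λ _ → τ-full a))

  invariant-operation-closed :
    ∀ {n k} (ms : Fin n → ℕ) → 1 ≤ k → (F : ((i : Fin n) → Rel A (ms i)) → Rel A k) →
    Extensional F → Invariant F → (σs : (i : Fin n) → Rel A (ms i)) →
    (∀ i → KA (AllRels ρ) (ms i) (σs i)) → ∀ {τ} → τ ≐ F σs → KA (AllRels ρ) k τ
  invariant-operation-closed ms 1≤k F F-ext F-inv σs σs∈KA {τ} τ≐F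
    with common-stage (λ i → KA-AllRels⇒Union (σs∈KA i))
  ... | M , 1≤M , stage = Union⇒KA-AllRels (M , 1≤M , sInvAut⊆KA M 1≤M (1≤k , inv))
    where
    inv : ∀ g → Aut (Upto ρ M) g → image g τ ≐ τ
    inv g aut b = image-cong g τ≐F b
                  ⟨⇔⟩ ⇔-sym (F-inv g σs b)
                  ⟨⇔⟩ F-ext _ _ (λ i → KA⊆sInvAut (stage i) g aut) b
                  ⟨⇔⟩ ⇔-sym (τ≐F b)

  record QfStableOn {k : ℕ} (P : (Fin k → A) → Set) : Set where
    field
      level   : ℕ
      1≤level : 1 ≤ level
      stable  : ∀ m → level ≤ m → (a b : Fin k → A) → P a → QfEq level a b → QfEq m a b

  QfStable : ℕ → Set
  QfStable k = QfStableOn {k} (λ _ → ⊤)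

  stable⇒aut-on-tuple : ∀ {k} (st : QfStable k) g → Aut (Upto ρ (QfStableOn.level st)) g →
                        ∀ m → 1 ≤ m → (u : Fin k → A) →
                        Σ (Perm A) λ g′ → Aut (Upto ρ m) g′ × (∀ i → ⟦ g′ ⟧ (u i) ≡ ⟦ g ⟧ (u i))
  stable⇒aut-on-tuple st g aut m 1≤m u =
    let u≈gu = stable (m ⊔ level) (m≤n⊔m m level) u (⟦ g ⟧ ∘ u) tt (QfEq-aut g aut ≤-refl u)
        (g′ , aut′ , g′-maps) = qfEq⇒aut (≤-trans 1≤m (m≤m⊔n m level)) u≈gu
    in g′ , Aut-antitone (m≤m⊔n m level) g′ aut′ , g′-maps
    where open QfStableOn st

  KA-invariant-at-stable-level : ∀ {k σ} (st : QfStable k) → KA (AllRels ρ) k σ →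
                                 ∀ g → Aut (Upto ρ (QfStableOn.level st)) g → ∀ u → σ u ⇔ σ (⟦ g ⟧ ∘ u)
  KA-invariant-at-stable-level {σ = σ} st h g aut u with KA-AllRels⇒Union h
  ... | m , 1≤m , h′ with stable⇒aut-on-tuple st g aut m 1≤m u
  ... | g′ , aut′ , g′-maps =
    invariant⇒pointwise g′ (KA⊆sInvAut h′ g′ aut′) u ⟨⇔⟩ mk⇔ (σ-resp g′-maps) (σ-resp (sym ∘ g′-maps))
    where
    σ-resp : Respects≗ σ
    σ-resp = KA-respects≗ AllRels-respects≗ h

  intersection-closed : ∀ {k} → 1 ≤ k → QfStable k → (S : Rel A k → Set₁) →
                        (∀ σ → S σ → KA (AllRels ρ) k σ) →
                        ∀ {τ} → (∀ a → τ a ⇔ (∀ σ → S σ → σ a)) → KA (AllRels ρ) k τ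
  intersection-closed 1≤k st S S⊆KA {τ} τ≐⋂ =
    Union⇒KA-AllRels (level , 1≤level , sInvAut⊆KA level 1≤level (1≤k , inv))
    where
    open QfStableOn st
    τ-resp : Respects≗ τ
    τ-resp e h = from (τ≐⋂ _) (λ σ s → KA-respects≗ AllRels-respects≗ (S⊆KA σ s) e (to (τ≐⋂ _) h σ s))
    inv : ∀ g → Aut (Upto ρ level) g → image g τ ≐ τ
    inv g aut = pointwise⇒invariant g τ-resp λ u →
      τ≐⋂ u
      ⟨⇔⟩ mk⇔ (λ h σ s → to   (KA-invariant-at-stable-level st (S⊆KA σ s) g aut u) (h σ s))
              (λ h σ s → from (KA-invariant-at-stable-level st (S⊆KA σ s) g aut u) (h σ s))
      ⟨⇔⟩ ⇔-sym (τ≐⋂ _)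

  module _ (qfStable : ∀ k → QfStable k) where

    InvCl⇒KA : ∀ {k σ} → InvCl (KA (AllRels ρ)) k σ → KA (AllRels ρ) k σ
    InvCl⇒KA (base h)                               = h
    InvCl⇒KA (op ms _ 1≤k F F-ext F-inv σs ch τ≐F) =
      invariant-operation-closed ms 1≤k F F-ext F-inv σs (InvCl⇒KA ∘ ch) τ≐F
    InvCl⇒KA (full 1≤k τ-full)                      = KA-full 1≤k τ-full
    InvCl⇒KA (inter {k} 1≤k S ch τ≐⋂)              =
      intersection-closed 1≤k (qfStable k) S (λ σ s → InvCl⇒KA (ch σ s)) τ≐⋂

    KA-AllRels≈InvCl : KA (AllRels ρ) ≈ₛ InvCl (KA (AllRels ρ))
    KA-AllRels≈InvCl k 1≤k σ = mk⇔ base InvCl⇒KA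

  -- A relation outside R

  Interp-respects≗ : ∀ s → Respects≗ (Interp ρ s)
  Interp-respects≗ s = ρ-respects≗ (suc s) (s≤s z≤n)

  open Satisfaction (Interp ρ) Interp-respects≗ using (sat-resp; sat-substitute)

  KA-AllRels⇒definable : ∀ {k σ} → KA (AllRels ρ) k σ → Σ (Formula ℕ Ar k) λ φ → σ ≐ Sat (Interp ρ) φ
  KA-AllRels⇒definable {suc k} (base (_ , σ≐ρ)) = atom k id , σ≐ρ
  KA-AllRels⇒definable (logical ar σs ch _ φ e) =
    substitute φ (λ i → proj₁ (KA-AllRels⇒definable (ch i))) ,
    λ u → e u ⟨⇔⟩ ⇔-sym (sat-substitute φ σs (λ i → proj₁ (KA-AllRels⇒definable (ch i)))
                                               (λ i → proj₂ (KA-AllRels⇒definable (ch i))) u)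

  rigid⇒sInvAut : Rigid ρ → ∀ {k} {σ : Rel A k} → 1 ≤ k → Respects≗ σ → sInv (Aut (KA (AllRels ρ))) k σ
  rigid⇒sInvAut rigid 1≤k σ-resp = 1≤k , λ g aut →
    let g-id = rigid g (λ k σ h → aut k σ (base h))
    in pointwise⇒invariant g σ-resp λ u → mk⇔ (σ-resp (sym ∘ g-id ∘ u)) (σ-resp (g-id ∘ u))

  module _ (infinite : Infinite A) where
    open InfiniteSet infinite using (injection; injection-injective)

    -- Cantor's diagonal argument against the enumeration of formulas, placed on distinct points.
    diagonal : Rel A 1
    diagonal a = Σ ℕ λ t → injection t ≡ a zero × ¬ Sat (Interp ρ) (enumerate 1 t) a

    diagonal-respects≗ : Respects≗ diagonal
    diagonal-respects≗ e (t , it , ¬sat) =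
      t , trans it (e zero) , ¬sat ∘ sat-resp (enumerate 1 t) (sym ∘ e)

    diagonal∉KA : ¬ KA (AllRels ρ) 1 diagonal
    diagonal∉KA h with KA-AllRels⇒definable h
    ... | φ , diagonal≐φ with enumerate-complete (Interp ρ) Interp-respects≗ φ
    ... | t , t≈φ = ¬diagonal-t (t , refl , ¬diagonal-t ∘ from (diagonal≐φ a) ∘ to (t≈φ a))
      where
      a : Fin 1 → A
      a _ = injection t
      ¬diagonal-t : ¬ diagonal a
      ¬diagonal-t d@(t′ , e , ¬sat) with injection-injective {t′} {t} e
      ... | refl = ¬sat (from (t≈φ a) (to (diagonal≐φ a) d))

    KA-AllRels⊂sInvAut : Rigid ρ →
      Σ ℕ λ k → Σ (Rel A k) λ σ → sInv (Aut (KA (AllRels ρ))) k σ × ¬ KA (AllRels ρ) k σ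
    KA-AllRels⊂sInvAut rigid =
      1 , diagonal , rigid⇒sInvAut rigid (s≤s z≤n) diagonal-respects≗ , diagonal∉KA

  -- Stability of quantifier-free types

  module _ (infinite : Infinite A) where
    open InfiniteSet infinite

    record AgreeBelow (L n : ℕ) (c c′ : ℕ → A) : Set where
      constructor agreeBelow
      field agree : ∀ j → 1 ≤ j → j ≤ L → (u : Fin j → ℕ) → (∀ x → u x < n) → ρ j (c ∘ u) ⇔ ρ j (c′ ∘ u)
    open AgreeBelow

    AgreeBelow-refl : ∀ {L n c} → AgreeBelow L n c c
    AgreeBelow-refl = agreeBelow λ j _ _ u _ → ⇔-refl

    AgreeBelow-trans : ∀ {L n c c′ c″} → AgreeBelow L n c c′ → AgreeBelow L n c′ c″ → AgreeBelow L n c c″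
    AgreeBelow-trans ag ag′ = agreeBelow λ j p q u u< → agree ag j p q u u< ⟨⇔⟩ agree ag′ j p q u u<

    AgreeBelow-mono : ∀ {L L′ n n′ c c′} → L′ ≤ L → n′ ≤ n → AgreeBelow L n c c′ → AgreeBelow L′ n′ c c′
    AgreeBelow-mono L′≤L n′≤n ag =
      agreeBelow λ j p q u u< → agree ag j p (≤-trans q L′≤L) u (λ x → ≤-trans (u< x) n′≤n)

    AgreeBelow-pointwise : ∀ {L n c c′} → (∀ i → i < n → c i ≡ c′ i) → AgreeBelow L n c c′
    AgreeBelow-pointwise c≡c′ = agreeBelow λ j p _ u u< → ρ-resp-⇔ j p (λ x → c≡c′ (u x) (u< x))

    AgreeBelow-aut : ∀ {L M n c} (g : Perm A) → Aut (Upto ρ M) g → L ≤ M → AgreeBelow L n c (⟦ g ⟧ ∘ c)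
    AgreeBelow-aut g aut L≤M = agreeBelow λ j p q _ _ → aut-pointwise g aut j p (≤-trans q L≤M) _

    injective-pattern : ∀ {n c r} → InjectiveBelow n c → (u : Fin r → ℕ) → (∀ x → u x < n) →
                        ∀ i i′ → (c (u i) ≡ c (u i′)) ⇔ (u i ≡ u i′)
    injective-pattern {c = c} inj u u< i i′ = mk⇔ (inj _ _ (u< i) (u< i′)) (cong c)

    AgreeBelow⇒QfEq : ∀ {L n c c′ r} → InjectiveBelow n c → InjectiveBelow n c′ → AgreeBelow L n c c′ →
                      (u : Fin r → ℕ) → (∀ x → u x < n) → QfEq L (c ∘ u) (c′ ∘ u)
    AgreeBelow⇒QfEq inj inj′ ag u u< =
      (λ i i′ → injective-pattern inj u u< i i′ ⟨⇔⟩ ⇔-sym (injective-pattern inj′ u u< i i′)) ,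
      (λ j p q f → agree ag j p q (u ∘ f) (u< ∘ f))

    extend-toℕ-agree : ∀ {L n c c′ N i} → InjectiveBelow n c → InjectiveBelow n c′ → AgreeBelow L n c c′ →
                       i < n → N ≤ n → QfEq L (extend (c i) (c ∘ toℕ {N})) (extend (c′ i) (c′ ∘ toℕ {N}))
    extend-toℕ-agree {c = c} {c′} {N} {i} inj inj′ ag i<n N≤n =
      QfEq-resp (∘-extend c i toℕ) (∘-extend c′ i toℕ) (AgreeBelow⇒QfEq inj inj′ ag (extend i toℕ) bounded)
      where
      bounded : ∀ x → extend i toℕ x < _
      bounded zero    = i<n
      bounded (suc x) = ≤-trans (toℕ<n x) N≤n

    restrict-extension : ∀ {r N L} {c c′ : ℕ → A} {x x′ : A} (b : Fin r → ℕ) → (∀ y → b y < N) →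
                         QfEq L (extend x (c ∘ toℕ {N})) (extend x′ (c′ ∘ toℕ {N})) →
                         QfEq L (extend x (c ∘ b)) (extend x′ (c′ ∘ b))
    restrict-extension {c = c} {c′} {x} {x′} b b< E =
      QfEq-resp (restricted {c}) (restricted {c′}) (QfEq-∘ (extend zero (λ y → suc (fromℕ< (b< y)))) E)
      where
      restricted : ∀ {d : ℕ → A} {z} →
                   extend z (d ∘ toℕ) ∘ extend zero (λ y → suc (fromℕ< (b< y))) ≗ extend z (d ∘ b)
      restricted zero    = refl
      restricted {d} (suc y) = cong d (toℕ-fromℕ< (b< y))

    record Adjustment (Inv : ℕ → (ℕ → A) → Set) (Post : ℕ → ℕ → (ℕ → A) → Set)
                      (n m : ℕ) (c : ℕ → A) : Set where
      field
        level′    : ℕ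
        seq′      : ℕ → A
        level<    : m < level′
        agrees    : AgreeBelow (suc m) n c seq′
        injective : InjectiveBelow n seq′
        invariant : Inv level′ seq′
        property  : Post n level′ seq′

    -- A chain of injective sequences c_t : ℕ → A whose first n_t entries are frozen up to
    -- ρ₁,…,ρ_{m_t+1}; its limit is a structure on ℕ. Witness tasks, interleaved with the
    -- caller's adjustments, make the limit a model of Th(A) by a back-and-forth argument.
    module Chain (n₀ m₀ : ℕ) (c₀ : ℕ → A) (c₀-injective : InjectiveBelow n₀ c₀)
                 (Inv : ℕ → (ℕ → A) → Set) (inv₀ : Inv m₀ c₀)
                 (Inv-resp : ∀ {m c c′} → (∀ i → i < n₀ → c i ≡ c′ i) → Inv m c → Inv m c′)
                 (Post : ℕ → ℕ → ℕ → (ℕ → A) → Set)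
                 (adjust : ∀ t n m c → n₀ ≤ n → InjectiveBelow n c → Inv m c → Adjustment Inv (Post t) n m c)
                 where

      record Stage : Set where
        constructor stage
        field
          size level : ℕ
          seq        : ℕ → A
          n₀≤size    : n₀ ≤ size
          injective  : InjectiveBelow size seq
          invariant  : Inv level seq
      open Stage

      representative : ℕ → (N : ℕ) → ℕ → Fin (suc N) → A
      representative L′ N = proj₁ (proj₂ (finitely-many-qfTypes (suc L′) (suc N) (λ _ → some-element)))

      -- Task (N , L′ , q): realise the type number q of (N+1)-tuples over ρ₁,…,ρ_{L′+1}
      -- as an extension of the first N entries.
      Task : Set
      Task = ℕ × ℕ × ℕ

      decodeTask : ℕ → Task
      decodeTask x = proj₁ (unpair x) , unpair (proj₂ (unpair x))

      decodeTask-pair : ∀ N L′ q → decodeTask (pair N (pair L′ q)) ≡ (N , L′ , q)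
      decodeTask-pair N L′ q rewrite unpair-pair N (pair L′ q) | unpair-pair L′ q = refl

      task : ℕ → Task
      task t = decodeTask (proj₁ (unpair t))

      RealisedBy : Task → (ℕ → A) → A → Set
      RealisedBy (N , L′ , q) c y = QfEq (suc L′) (extend y (c ∘ toℕ {N})) (representative L′ N q)

      Applicable : Task → Stage → Set
      Applicable (N , L′ , q) s = N ≤ size s × L′ ≤ level s ×
                                  QfEq (suc L′) (representative L′ N q ∘ suc) (seq s ∘ toℕ {N})

      Realised : Task → Stage → Set
      Realised τ s = Σ ℕ λ i → i < size s × RealisedBy τ (seq s) (seq s i)

      witness : (τ : Task) (s : Stage) →
                Σ A λ y → Fresh (size s) (seq s) y × (Applicable τ s → Realised τ s ⊎ RealisedBy τ (seq s) y)
      witness τ@(N , L′ , q) s with dec (Applicable τ s) | dec (Realised τ s)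
      ... | no ¬app | _ = let (y , fr) = fresh _ _ (injective s) in y , fr , ⊥-elim ∘ ¬app
      ... | yes _ | yes r = let (y , fr) = fresh _ _ (injective s) in y , fr , λ _ → inj₁ r
      ... | yes (_ , _ , E) | no ¬r with qfEq⇒aut (s≤s z≤n) E
      ...   | g , aut , g-maps = y , y-fresh , λ _ → inj₂ y-realises
        where
        y = ⟦ g ⟧ (representative L′ N q zero)
        y-realises : RealisedBy τ (seq s) y
        y-realises = QfEq-sym (QfEq-resp (λ _ → refl) (λ { zero → refl ; (suc x) → g-maps x })
                                         (QfEq-aut g aut ≤-refl (representative L′ N q)))
        y-fresh : Fresh (size s) (seq s) y
        y-fresh i i<n e =
          ¬r (i , i<n , QfEq-resp (λ { zero → sym e ; (suc x) → refl }) (λ _ → refl) y-realises)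

      record Step (t : ℕ) (s : Stage) : Set where
        field
          next     : Stage
          size-suc : size next ≡ suc (size s)
          level<   : level s < level next
          agrees   : AgreeBelow (suc (level s)) (size s) (seq s) (seq next)
          realises : Applicable (task t) s → Realised (task t) next
          property : Post t (suc (size s)) (level next) (seq next)

      -- Append a witness for task t at position size s, then let the caller adjust.
      abstract
        step : (t : ℕ) (s : Stage) → Step t s
        step t s = record
          { next     = next
          ; size-suc = refl
          ; level<   = level<
          ; agrees   = AgreeBelow-trans (AgreeBelow-pointwise (λ i → seq≡c₁))
                                        (AgreeBelow-mono ≤-refl (n≤1+n _) agrees)
          ; realises = realises
          ; property = property
          }
          where
          W : Σ A λ y → Fresh (size s) (seq s) y ×
                        (Applicable (task t) s → Realised (task t) s ⊎ RealisedBy (task t) (seq s) y)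
          W = witness (task t) s
          y : A
          y = proj₁ W
          c₁ : ℕ → A
          c₁ = update (size s) y (seq s)
          seq≡c₁ : ∀ {i} → i < size s → seq s i ≡ c₁ i
          seq≡c₁ i<n = sym (update-< {size s} {y} {seq s} i<n)
          c₁-injective : InjectiveBelow (suc (size s)) c₁
          c₁-injective = update-injective {size s} {y} {seq s} (Stage.injective s) (proj₁ (proj₂ W))
          c₁-invariant : Inv (level s) c₁
          c₁-invariant = Inv-resp {level s} {seq s} {c₁} (λ i i<n₀ → seq≡c₁ (≤-trans i<n₀ (n₀≤size s)))
                                  (Stage.invariant s)
          open Adjustment (adjust t (suc (size s)) (level s) c₁ (≤-trans (n₀≤size s) (n≤1+n _))
                                  c₁-injective c₁-invariant)
            renaming (injective to seq′-injective; invariant to seq′-invariant)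
          transport : ∀ {N L′ q i} → i < suc (size s) → N ≤ size s → L′ ≤ level s →
                      RealisedBy (N , L′ , q) c₁ (c₁ i) → RealisedBy (N , L′ , q) seq′ (seq′ i)
          transport {N} {L′} {q} {i} i< N≤n L′≤m =
            QfEq-trans {b = extend (c₁ i) (c₁ ∘ toℕ {N})}
              (QfEq-sym (QfEq-mono (s≤s L′≤m)
                (extend-toℕ-agree {c = c₁} {c′ = seq′} {N = N} {i = i}
                                  c₁-injective seq′-injective agrees i< (≤-trans N≤n (n≤1+n _)))))
          next : Stage
          next = stage (suc (size s)) level′ seq′ (≤-trans (n₀≤size s) (n≤1+n _))
                       seq′-injective seq′-invariant
          old-witness : ∀ {N L′ q} → N ≤ size s → L′ ≤ level s →
                        Realised (N , L′ , q) s → Realised (N , L′ , q) next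
          old-witness {N} {L′} {q} N≤n L′≤m (i , i<n , r) =
            i , ≤-trans i<n (n≤1+n _) ,
            transport {N} {L′} {q} {i} (≤-trans i<n (n≤1+n _)) N≤n L′≤m
              (QfEq-resp {a = extend (seq s i) (seq s ∘ toℕ {N})} {a′ = extend (c₁ i) (c₁ ∘ toℕ {N})}
                         (λ { zero → seq≡c₁ i<n ; (suc x) → seq≡c₁ (≤-trans (toℕ<n x) N≤n) }) (λ _ → refl) r)
          new-witness : ∀ {N L′ q} → N ≤ size s → L′ ≤ level s → RealisedBy (N , L′ , q) (seq s) y →
                        Realised (N , L′ , q) next
          new-witness {N} {L′} {q} N≤n L′≤m r =
            size s , ≤-refl ,
            transport {N} {L′} {q} {size s} ≤-refl N≤n L′≤m
              (QfEq-resp {a = extend y (seq s ∘ toℕ {N})} {a′ = extend (c₁ (size s)) (c₁ ∘ toℕ {N})}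
                         (λ { zero    → sym (update-≡ {size s} {y} {seq s})
                            ; (suc x) → seq≡c₁ (≤-trans (toℕ<n x) N≤n) })
                         (λ _ → refl) r)
          realises : Applicable (task t) s → Realised (task t) next
          realises app@(N≤n , L′≤m , _) =
            [ old-witness N≤n L′≤m , new-witness N≤n L′≤m ]′ (proj₂ (proj₂ W) app)

      chain : ℕ → Stage
      chain zero    = stage n₀ m₀ c₀ ≤-refl c₀-injective inv₀
      chain (suc t) = Step.next (step t (chain t))

      nT : ℕ → ℕ
      nT t = size (chain t)
      mT : ℕ → ℕ
      mT t = level (chain t)
      cT : ℕ → ℕ → A
      cT t = seq (chain t)

      steps : ∀ t → Step t (chain t)
      steps t = step t (chain t)

      nT≡n₀+t : ∀ t → nT t ≡ n₀ + t
      nT≡n₀+t zero    = sym (+-identityʳ n₀)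
      nT≡n₀+t (suc t) = trans (Step.size-suc (steps t)) (trans (cong suc (nT≡n₀+t t)) (sym (+-suc n₀ t)))

      t≤nT : ∀ t → t ≤ nT t
      t≤nT t = subst (t ≤_) (sym (nT≡n₀+t t)) (m≤n+m t n₀)

      t≤mT : ∀ t → t ≤ mT t
      t≤mT zero    = z≤n
      t≤mT (suc t) = ≤-trans (s≤s (t≤mT t)) (Step.level< (steps t))

      record Later (t t′ : ℕ) : Set where
        field
          size≤  : nT t ≤ nT t′
          level≤ : mT t ≤ mT t′
          agrees : AgreeBelow (suc (mT t)) (nT t) (cT t) (cT t′)

      later′ : ∀ {t t′} → t ≤′ t′ → Later t t′
      later′ ≤′-refl = record { size≤ = ≤-refl ; level≤ = ≤-refl ; agrees = AgreeBelow-refl }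
      later′ {t} (≤′-step {t′} t≤′t′) = record
        { size≤  = ≤-trans size≤ (subst (nT t′ ≤_) (sym (Step.size-suc (steps t′))) (n≤1+n _))
        ; level≤ = ≤-trans level≤ (<⇒≤ (Step.level< (steps t′)))
        ; agrees = AgreeBelow-trans agrees (AgreeBelow-mono (s≤s level≤) size≤ (Step.agrees (steps t′)))
        }
        where open Later (later′ t≤′t′)

      later : ∀ {t t′} → t ≤ t′ → Later t t′
      later t≤t′ = later′ (≤⇒≤′ t≤t′)

      later-QfEq : ∀ {t t′ r L} (u : Fin r → ℕ) → t ≤ t′ → (∀ x → u x < nT t) → L ≤ suc (mT t) →
                   QfEq L (cT t ∘ u) (cT t′ ∘ u)
      later-QfEq {t} {t′} u t≤t′ u< L≤ =
        QfEq-mono L≤ (AgreeBelow⇒QfEq (injective (chain t)) (InjectiveBelow-mono size≤ (injective (chain t′)))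
                                      agrees u u<)
        where open Later (later t≤t′)

      limit : (s : ℕ) → Rel ℕ (Ar s)
      limit s u = Σ ℕ λ t → (∀ x → u x < nT t) × s ≤ mT t × ρ (suc s) (cT t ∘ u)

      limit-at : ∀ s u t → (∀ x → u x < nT t) → s ≤ mT t → limit s u ⇔ ρ (suc s) (cT t ∘ u)
      limit-at s u t u< s≤m = mk⇔ (λ (t₀ , u<₀ , s≤m₀ , r) → via t₀ u<₀ s≤m₀ r) (λ r → t , u< , s≤m , r)
        where
        via : ∀ t₀ → (∀ x → u x < nT t₀) → s ≤ mT t₀ → ρ (suc s) (cT t₀ ∘ u) → ρ (suc s) (cT t ∘ u)
        via t₀ u<₀ s≤m₀ =
          from (AgreeBelow.agree (Later.agrees (later (m≤n⊔m t₀ t))) (suc s) (s≤s z≤n) (s≤s s≤m) u u<) ∘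
          to (AgreeBelow.agree (Later.agrees (later (m≤m⊔n t₀ t))) (suc s) (s≤s z≤n) (s≤s s≤m₀) u u<₀)

      Corresponds : ℕ → ∀ {r} → (Fin r → ℕ) → (Fin r → A) → Set
      Corresponds L b ā = Σ ℕ λ t → (∀ x → b x < nT t) × L ≤ suc (mT t) × QfEq L (cT t ∘ b) ā

      Corresponds-later : ∀ {L r} {b : Fin r → ℕ} {ā} t t′ → t ≤ t′ → (∀ x → b x < nT t) → L ≤ suc (mT t) →
                          QfEq L (cT t ∘ b) ā → QfEq L (cT t′ ∘ b) ā
      Corresponds-later t t′ t≤t′ b< L≤ E = QfEq-trans (QfEq-sym (later-QfEq _ t≤t′ b< L≤)) E

      -- The task coding the extension recurs after every stage.
      extension-realised : ∀ L′ t → L′ ≤ mT t → (x : A) →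
        Σ ℕ λ t′ → t ≤ t′ × Σ ℕ λ i → i < nT t′ ×
          QfEq (suc L′) (extend (cT t′ i) (cT t′ ∘ toℕ {nT t})) (extend x (cT t ∘ toℕ {nT t}))
      extension-realised L′ t L′≤m x
        with proj₂ (proj₂ (finitely-many-qfTypes (suc L′) (suc (nT t)) (λ _ → some-element)))
                   (extend x (cT t ∘ toℕ))
      ... | q , _ , x≈q with unpair-recurrent (pair (nT t) (pair L′ q)) t
      ... | t₀ , t≤t₀ , code≡
        with subst (λ τ → Applicable τ (chain t₀) → Realised τ (chain (suc t₀)))
                   (trans (cong decodeTask code≡) (decodeTask-pair (nT t) L′ q))
                   (Step.realises (steps t₀)) applicable
        where
        open Later (later t≤t₀)
        applicable : Applicable (nT t , L′ , q) (chain t₀)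
        applicable = size≤ , ≤-trans L′≤m level≤ ,
                     QfEq-trans (QfEq-sym (QfEq-∘ suc x≈q)) (later-QfEq toℕ t≤t₀ toℕ<n (s≤s L′≤m))
      ... | i , i< , realised = suc t₀ , ≤-trans t≤t₀ (n≤1+n t₀) , i , i< , QfEq-trans realised (QfEq-sym x≈q)

      symbols : ∀ {k} → Formula ℕ Ar k → ℕ
      symbols (atom s v)  = suc s
      symbols (equal x y) = 0
      symbols (neg φ)     = symbols φ
      symbols (and φ ψ)   = symbols φ ⊔ symbols ψ
      symbols (ex φ)      = symbols φ

      module _ {L′ : ℕ} where

        forth : ∀ {r} (b : Fin r → ℕ) ā → Corresponds (suc L′) b ā →
                ∀ y → Σ A λ a → Corresponds (suc L′) (extend y b) (extend a ā)
        forth b ā (t , b< , L≤ , E) y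
          with qfEq⇒aut (s≤s z≤n) (Corresponds-later t t′ (m≤m⊔n t _) b< L≤ E)
          where t′ = t ⊔ suc y
        ... | g , aut , g-maps =
          ⟦ g ⟧ (cT t′ y) , t′ , extended< , ≤-trans L≤ (s≤s level≤) ,
          QfEq-resp (λ _ → refl) (λ { zero → refl ; (suc x) → g-maps x })
                    (QfEq-aut g aut ≤-refl (cT t′ ∘ extend y b))
          where
          t′ = t ⊔ suc y
          open Later (later (m≤m⊔n t (suc y)))
          extended< : ∀ x → extend y b x < nT t′
          extended< zero    = ≤-trans (m≤n⊔m t (suc y)) (t≤nT t′)
          extended< (suc x) = ≤-trans (b< x) size≤

        back : ∀ {r} (b : Fin r → ℕ) ā → Corresponds (suc L′) b ā →
               ∀ a → Σ ℕ λ y → Corresponds (suc L′) (extend y b) (extend a ā)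
        back b ā (t , b< , L≤ , E) a with qfEq⇒aut (s≤s z≤n) (QfEq-sym E)
        ... | g , aut , g-maps with extension-realised L′ t (≤-pred L≤) (⟦ g ⟧ a)
        ... | t′ , t≤t′ , i , i< , realised =
          i , t′ , extended< , ≤-trans L≤ (s≤s level≤) ,
          QfEq-resp (sym ∘ ∘-extend (cT t′) i b) (λ _ → refl)
            (QfEq-trans (restrict-extension {c = cT t′} {c′ = cT t} b b< realised)
                        (QfEq-sym (QfEq-resp (λ _ → refl) (λ { zero → refl ; (suc x) → g-maps x })
                                             (QfEq-aut g aut ≤-refl (extend a ā)))))
          where
          open Later (later t≤t′)
          extended< : ∀ x → extend i b x < nT t′
          extended< zero    = i<
          extended< (suc x) = ≤-trans (b< x) size≤

      sat-limit : ∀ {r} (φ : Formula ℕ Ar r) L′ → symbols φ ≤ suc L′ →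
                  ∀ b ā → Corresponds (suc L′) b ā → Sat limit φ b ⇔ Sat (Interp ρ) φ ā
      sat-limit (atom s v)  L′ s<L b ā (t , b< , L≤ , E) =
        limit-at s (b ∘ v) t (b< ∘ v) (≤-pred (≤-trans s<L L≤)) ⟨⇔⟩ proj₂ E (suc s) (s≤s z≤n) s<L v
      sat-limit (equal x y) L′ _   b ā (t , b< , L≤ , E) =
        ⇔-sym (injective-pattern (injective (chain t)) b b< x y) ⟨⇔⟩ proj₁ E x y
      sat-limit (neg φ)     L′ s≤L b ā C = ¬-cong-⇔ (sat-limit φ L′ s≤L b ā C)
      sat-limit (and φ ψ)   L′ s≤L b ā C =
        sat-limit φ L′ (≤-trans (m≤m⊔n _ _) s≤L) b ā C ×-⇔ sat-limit ψ L′ (≤-trans (m≤n⊔m _ _) s≤L) b ā C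
      sat-limit (ex φ)      L′ s≤L b ā C = mk⇔
        (λ (y , h) → let (a , C′) = forth b ā C y
                     in a , to (sat-limit φ L′ s≤L (extend y b) (extend a ā) C′) h)
        (λ (a , h) → let (y , C′) = back b ā C a
                     in y , from (sat-limit φ L′ s≤L (extend y b) (extend a ā) C′) h)

      limit-model : ModelOfTh ρ limit
      limit-model φ =
        from (sat-limit φ (symbols φ) (n≤1+n _) empty empty
                        (symbols φ , (λ ()) , s≤s (t≤mT (symbols φ)) , QfEq-empty))

      limit-relations : ∀ {r L} t (u : Fin r → ℕ) → (∀ x → u x < nT t) → L ≤ mT t →
                        ∀ j → j ≤ L → (f : Fin (suc j) → Fin r) → ρ (suc j) (cT t ∘ u ∘ f) ⇔ limit j (u ∘ f)
      limit-relations t u u< L≤m j j≤L f = ⇔-sym (limit-at j (u ∘ f) t (u< ∘ f) (≤-trans j≤L L≤m))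

    module Branch (k : ℕ) where

      Tuple : Set
      Tuple = Fin k → A

      SplitAt : (Tuple → Set) → ℕ → Set
      SplitAt Q M = Σ ℕ λ m → Σ Tuple λ b → Σ Tuple λ b′ →
                    Q b × Q b′ × QfEq (suc M) b b′ × ¬ QfEq (suc m) b b′

      Splits : (Tuple → Set) → ℕ → Set
      Splits Q ℓ = ∀ M → ℓ ≤ M → SplitAt Q M

      SplitAt-weaken : ∀ {Q Q′ : Tuple → Set} {M} → (∀ {b} → Q b → Q′ b) → SplitAt Q M → SplitAt Q′ M
      SplitAt-weaken Q⊆Q′ (m , b , b′ , Qb , Qb′ , E , ¬E) = m , b , b′ , Q⊆Q′ Qb , Q⊆Q′ Qb′ , E , ¬E

      SplitAt-antitone : ∀ {Q M M′} → M ≤ M′ → SplitAt Q M′ → SplitAt Q M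
      SplitAt-antitone M≤M′ (m , b , b′ , Qb , Qb′ , E , ¬E) =
        m , b , b′ , Qb , Qb′ , QfEq-mono (s≤s M≤M′) E , ¬E

      ¬Splits⇒bound : ∀ {Q ℓ} → ¬ Splits Q ℓ → Σ ℕ λ M → ∀ M′ → M ≤ M′ → ¬ SplitAt Q M′
      ¬Splits⇒bound {Q} {ℓ} ¬splits with dec (Σ ℕ λ M → ℓ ≤ M × ¬ SplitAt Q M)
      ... | yes (M , _ , ¬split) = M , λ M′ M≤M′ → ¬split ∘ SplitAt-antitone M≤M′
      ... | no ¬bound =
        ⊥-elim (¬splits λ M ℓ≤M → decidable-stable (dec _) λ ¬split → ¬bound (M , ℓ≤M , ¬split))

      -- There are finitely many types at level ℓ+1; if none of them split, a common bound
      -- on their splitting levels contradicts the splitting of Q.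
      pigeonhole : ∀ {Q ℓ} → Splits Q ℓ → Σ Tuple λ r → Q r × Splits (Q ∩ QfEq (suc ℓ) r) ℓ
      pigeonhole {Q} {ℓ} splits with finitely-many-qfTypes (suc ℓ) k (λ _ → some-element)
      ... | R , rep , cover with dec (Σ ℕ λ q → q < R × Splits (Q ∩ QfEq (suc ℓ) (rep q)) ℓ)
      ... | yes (q , _ , splits-q) =
        let (_ , b , _ , (Qb , rep≈b) , _) = splits-q ℓ ≤-refl
        in b , Qb , λ M ℓ≤M →
             SplitAt-weaken (λ (Qx , rep≈x) → Qx , QfEq-trans (QfEq-sym rep≈b) rep≈x) (splits-q M ℓ≤M)
      ... | no ¬splits-q =
        let (M , bounded) = common-bound (λ q M → ∀ M′ → M ≤ M′ → ¬ SplitAt (Q ∩ QfEq (suc ℓ) (rep q)) M′)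
                                         (λ q M≤M′ h M″ M′≤M″ → h M″ (≤-trans M≤M′ M′≤M″)) R
                                         (λ q q<R → ¬Splits⇒bound (λ s → ¬splits-q (q , q<R , s)))
            (m , b , b′ , Qb , Qb′ , b≈b′ , ¬b≈b′) = splits (M ⊔ ℓ) (m≤n⊔m M ℓ)
            (q , q<R , b≈rep) = cover b
        in ⊥-elim (bounded q q<R (M ⊔ ℓ) (m≤m⊔n M ℓ)
             (m , b , b′ , (Qb , QfEq-sym b≈rep) ,
              (Qb′ , QfEq-trans (QfEq-sym b≈rep) (QfEq-mono (s≤s (m≤n⊔m M ℓ)) b≈b′)) , b≈b′ , ¬b≈b′))

      -- An infinite path through the finitely branching tree of types, staying inside a
      -- splitting node at every level: the limit type is non-isolated.
      module _ (unstable : ¬ QfStableOn {k} Injective) where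

        root-splits : Splits Injective 0
        root-splits M _ = decidable-stable (dec _) λ ¬split → unstable record
          { level   = suc M
          ; 1≤level = s≤s z≤n
          ; stable  = λ { (suc m) M<m a b a-inj E → decidable-stable (dec _) λ ¬E →
                          ¬split (m , a , b , a-inj , QfEq-injective E a-inj , E , ¬E) }
          }

        Node : ℕ → Tuple → Set
        Node ℓ r = Splits (QfEq (suc ℓ) r) ℓ

        child : ∀ ℓ r → Node ℓ r → Σ Tuple λ r′ → QfEq (suc ℓ) r r′ × Node (suc ℓ) r′
        child ℓ r node =
          let (r′ , r≈r′ , splits) = pigeonhole (λ M ℓ<M → node M (≤-trans (n≤1+n ℓ) ℓ<M))
          in r′ , r≈r′ , λ M ℓ<M → SplitAt-weaken proj₂ (splits M ℓ<M)

        branch : (ℓ : ℕ) → Σ Tuple λ r → Injective r × Node ℓ r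
        branch zero =
          let (r , r-inj , splits) = pigeonhole root-splits
          in r , r-inj , λ M _ → SplitAt-weaken proj₂ (splits M z≤n)
        branch (suc ℓ) =
          let (r , r-inj , node) = branch ℓ
              (r′ , r≈r′ , node′) = child ℓ r node
          in r′ , QfEq-injective r≈r′ r-inj , node′

        path : ℕ → Tuple
        path ℓ = proj₁ (branch ℓ)

        path-injective : ∀ ℓ → Injective (path ℓ)
        path-injective ℓ = proj₁ (proj₂ (branch ℓ))

        path-step : ∀ ℓ → QfEq (suc ℓ) (path ℓ) (path (suc ℓ))
        path-step ℓ = proj₁ (proj₂ (child ℓ (path ℓ) (proj₂ (proj₂ (branch ℓ)))))

        path-coherent′ : ∀ {ℓ ℓ′} → ℓ ≤′ ℓ′ → QfEq (suc ℓ) (path ℓ) (path ℓ′)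
        path-coherent′ ≤′-refl            = QfEq-refl
        path-coherent′ (≤′-step {ℓ′} ℓ≤ℓ′) =
          QfEq-trans (path-coherent′ ℓ≤ℓ′) (QfEq-mono (s≤s (≤′⇒≤ ℓ≤ℓ′)) (path-step ℓ′))

        path-coherent : ∀ {ℓ ℓ′} → ℓ ≤ ℓ′ → QfEq (suc ℓ) (path ℓ) (path ℓ′)
        path-coherent ℓ≤ℓ′ = path-coherent′ (≤⇒≤′ ℓ≤ℓ′)

        non-isolated : ∀ ℓ → Σ ℕ λ m → ℓ ≤ m ×
                       Σ Tuple λ e → QfEq (suc ℓ) e (path ℓ) × ¬ QfEq (suc m) e (path m)
        non-isolated ℓ with proj₂ (proj₂ (branch ℓ)) ℓ ≤-refl
        ... | m , b , b′ , path≈b , path≈b′ , b≈b′ , ¬b≈b′ with dec (QfEq (suc (m ⊔ ℓ)) b (path (m ⊔ ℓ)))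
        ... | yes b≈path = m ⊔ ℓ , m≤n⊔m m ℓ , b′ , QfEq-sym path≈b′ ,
                           λ b′≈path →
                             ¬b≈b′ (QfEq-mono (s≤s (m≤m⊔n m ℓ)) (QfEq-trans b≈path (QfEq-sym b′≈path)))
        ... | no ¬b≈path = m ⊔ ℓ , m≤n⊔m m ℓ , b , QfEq-sym path≈b , ¬b≈path

    -- If the branch's limit type is non-isolated, one chain omits it and another realises it;
    -- both limits are countable models of Th(A), so ω-categoricity is contradicted.
    module Omit&Realise (k : ℕ) (unstable : ¬ QfStableOn {k} Injective) where
      open Branch k

      P : ℕ → Tuple
      P = path unstable

      decodeIndices : ℕ → Fin k → ℕ
      decodeIndices t = decodeTuple id k (proj₁ (unpair t))

      Omits : ℕ → ℕ → ℕ → (ℕ → A) → Set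
      Omits t n m c = (∀ x → decodeIndices t x < n) → ¬ QfEq (suc m) (c ∘ decodeIndices t) (P m)

      -- If the tuple coded by t still follows P, move it onto a tuple that leaves P higher up.
      omit : ∀ t n m c → 0 ≤ n → InjectiveBelow n c → ⊤ → Adjustment (λ _ _ → ⊤) (Omits t) n m c
      omit t n m c _ c-inj _
        with dec ((∀ x → decodeIndices t x < n) × QfEq (suc m) (c ∘ decodeIndices t) (P m))
      ... | no ¬E = record
        { level′ = suc m ; seq′ = c ; level< = ≤-refl ; agrees = AgreeBelow-refl ; injective = c-inj
        ; invariant = tt
        ; property = λ in-range E → ¬E (in-range , QfEq-trans (QfEq-mono (n≤1+n _) E)
                                                              (QfEq-sym (path-coherent unstable (n≤1+n m))))
        }
      ... | yes (_ , E) with non-isolated unstable m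
      ... | m″ , m≤m″ , e , e≈P , ¬e≈P with qfEq⇒aut (s≤s z≤n) (QfEq-trans E (QfEq-sym e≈P))
      ... | g , aut , g-maps = record
        { level′ = suc m ⊔ m″ ; seq′ = ⟦ g ⟧ ∘ c ; level< = m≤m⊔n (suc m) m″
        ; agrees = AgreeBelow-aut g aut ≤-refl
        ; injective = λ i j i< j< e → c-inj i j i< j< (⟦⟧-injective g e)
        ; invariant = tt
        ; property  = λ _ E′ →
            ¬e≈P (QfEq-trans (QfEq-mono (s≤s (m≤n⊔m (suc m) m″)) (QfEq-resp g-maps (λ _ → refl) E′))
                             (QfEq-sym (path-coherent unstable (m≤n⊔m (suc m) m″))))
        }

      initial : ℕ → A
      initial i with i <? k
      ... | yes i<k = P 0 (fromℕ< i<k)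
      ... | no _    = some-element

      initial-< : ∀ {i} (i<k : i < k) → initial i ≡ P 0 (fromℕ< i<k)
      initial-< {i} i<k with i <? k
      ... | yes _   = refl
      ... | no i≮k = ⊥-elim (i≮k i<k)

      initial-toℕ : ∀ x → initial (toℕ x) ≡ P 0 x
      initial-toℕ x = trans (initial-< (toℕ<n x)) (cong (P 0) (fromℕ<-toℕ x (toℕ<n x)))

      initial-injective : InjectiveBelow k initial
      initial-injective i j i<k j<k e =
        trans (sym (toℕ-fromℕ< i<k))
              (trans (cong toℕ (path-injective unstable 0 _ _
                                  (trans (sym (initial-< i<k)) (trans e (initial-< j<k)))))
                     (toℕ-fromℕ< j<k))

      Realises : ℕ → (ℕ → A) → Set
      Realises m c = QfEq (suc m) (c ∘ toℕ {k}) (P m)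

      NoCondition : ℕ → ℕ → ℕ → (ℕ → A) → Set
      NoCondition _ _ _ _ = ⊤

      realise : ∀ t n m c → k ≤ n → InjectiveBelow n c → Realises m c →
                Adjustment Realises (NoCondition t) n m c
      realise t n m c _ c-inj E with qfEq⇒aut (s≤s z≤n) (QfEq-trans E (path-coherent unstable (n≤1+n m)))
      ... | g , aut , g-maps = record
        { level′ = suc m ; seq′ = ⟦ g ⟧ ∘ c ; level< = ≤-refl
        ; agrees = AgreeBelow-aut g aut ≤-refl
        ; injective = λ i j i< j< e → c-inj i j i< j< (⟦⟧-injective g e)
        ; invariant = QfEq-resp (sym ∘ g-maps) (λ _ → refl) QfEq-refl
        ; property = tt
        }

      Realises-initial : Realises 0 initial
      Realises-initial = QfEq-resp (sym ∘ initial-toℕ) (λ _ → refl) QfEq-refl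

      Realises-resp : ∀ {m c c′} → (∀ i → i < k → c i ≡ c′ i) → Realises m c → Realises m c′
      Realises-resp c≡c′ = QfEq-resp (λ x → c≡c′ (toℕ x) (toℕ<n x)) (λ _ → refl)

      module Omitting = Chain 0 0 (λ _ → some-element) (λ i j ()) (λ _ _ → ⊤) tt (λ _ _ → tt) Omits omit
      module Realising = Chain k 0 initial initial-injective Realises
                               Realises-initial
                               Realises-resp
                               (λ _ _ _ _ → ⊤) realise

      omitted : ∀ (v : Fin k → ℕ) → Σ ℕ λ t → (∀ x → v x < Omitting.nT t) ×
                ¬ QfEq (suc (Omitting.mT t)) (Omitting.cT t ∘ v) (P (Omitting.mT t))
      omitted v with unpair-recurrent (encodeTuple id k v) (suc (max k v))
      ... | t , bound≤t , code≡ =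
        suc t , v<n ,
        λ E → Step.property (steps t) (λ x → subst₂ _<_ (sym (decoded x)) (Step.size-suc (steps t)) (v<n x))
                (QfEq-resp (cong (cT (suc t)) ∘ sym ∘ decoded) (λ _ → refl) E)
        where
        open Omitting
        decoded : decodeIndices t ≗ v
        decoded x rewrite code≡ = decode-encodeTuple id id (λ _ → refl) k v x
        v<n : ∀ x → v x < nT (suc t)
        v<n x = ≤-trans (s≤s (≤-max k v x))
                        (≤-trans bound≤t (≤-trans (t≤nT t) (Later.size≤ (later (n≤1+n t)))))

      realised : ∀ m → (∀ x → toℕ x < Realising.nT m) × m ≤ Realising.mT m ×
                 QfEq (suc m) (Realising.cT m ∘ toℕ) (P m)
      realised m = (λ x → ≤-trans (toℕ<n x) (n₀≤size (chain m))) , t≤mT m ,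
                   QfEq-trans (QfEq-mono (s≤s (t≤mT m)) (invariant (chain m)))
                              (QfEq-sym (path-coherent unstable (t≤mT m)))
        where open Realising
              open Stage

      module _ (h : ℕ ↔ ℕ) (h-iso : ∀ s b → Omitting.limit s b ⇔ Realising.limit s (⟦ h ⟧ ∘ b)) where

        transfer : ∀ {r L} (u : Fin r → ℕ) t t′ →
                   (∀ x → u x < Omitting.nT t) → (∀ x → ⟦ h ⟧ (u x) < Realising.nT t′) →
                   L ≤ Omitting.mT t → L ≤ Realising.mT t′ →
                   QfEq (suc L) (Omitting.cT t ∘ u) (Realising.cT t′ ∘ ⟦ h ⟧ ∘ u)
        transfer u t t′ u< hu< L≤ L≤′ =
          (λ i i′ → injective-pattern (Omitting.Stage.injective (Omitting.chain t)) u u< i i′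
                    ⟨⇔⟩ mk⇔ (cong (⟦ h ⟧)) (⟦⟧-injective h)
                    ⟨⇔⟩ ⇔-sym (injective-pattern (Realising.Stage.injective (Realising.chain t′))
                                                 (⟦ h ⟧ ∘ u) hu< i i′)) ,
          (λ { (suc j) 1≤j j≤L f →
               Omitting.limit-relations t u u< L≤ j (≤-pred j≤L) f
               ⟨⇔⟩ h-iso j (u ∘ f)
               ⟨⇔⟩ ⇔-sym (Realising.limit-relations t′ (⟦ h ⟧ ∘ u) hu< L≤′ j (≤-pred j≤L) f) })

        contradiction : ⊥
        contradiction =
          let (t , v< , ¬v≈P) = omitted (⟦ h ⟧⁻¹ ∘ toℕ)
              m = Omitting.mT t
              (k< , m≤ , realises) = realised m
          in ¬v≈P (QfEq-trans (QfEq-resp (λ _ → refl) (λ x → cong (Realising.cT m) (⟦⟧∘⟦⟧⁻¹ h (toℕ x)))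
                                         (transfer (⟦ h ⟧⁻¹ ∘ toℕ) t m v<
                                                   (λ x → subst (_< Realising.nT m)
                                                                (sym (⟦⟧∘⟦⟧⁻¹ h (toℕ x))) (k< x))
                                                   ≤-refl m≤))
                              realises)

    module _ (ω-categorical : OmegaCategorical ρ) where

      injective-stable : ∀ k → QfStableOn {k} Injective
      injective-stable k = decidable-stable (dec _) λ unstable →
        let open Omit&Realise k unstable
            (h , h-iso) = ω-categorical ℕ ℕ Omitting.limit Realising.limit (↔-id ℕ) (↔-id ℕ)
                                        Omitting.limit-model Realising.limit-model
        in contradiction h h-iso

      -- Deduplicating a k-tuple leaves an injective tuple of length at most k.
      qf-stable : ∀ k → QfStable k
      qf-stable k = record { level = suc M ; 1≤level = s≤s z≤n ; stable = stable }
        where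
        level : ℕ → ℕ
        level r = QfStableOn.level (injective-stable r)
        M = max (suc k) (level ∘ toℕ)
        level≤M : ∀ {r} → r ≤ k → level r ≤ M
        level≤M r≤k = subst (λ r → level r ≤ M) (toℕ-fromℕ< (s≤s r≤k))
                            (≤-max (suc k) (level ∘ toℕ) (fromℕ< (s≤s r≤k)))
        stable : ∀ m → suc M ≤ m → (a b : Fin k → A) → ⊤ → QfEq (suc M) a b → QfEq m a b
        stable m M<m a b _ E = QfEq-resp a-embed b-embed (QfEq-∘ index E′)
          where
          open Deduplication (deduplicate a)
          level≤ : level size ≤ suc M
          level≤ = ≤-trans (level≤M size≤) (n≤1+n M)
          E′ : QfEq m (a ∘ embed) (b ∘ embed)
          E′ = QfStableOn.stable (injective-stable size) m (≤-trans level≤ M<m) (a ∘ embed) (b ∘ embed)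
                                 injective (QfEq-mono level≤ (QfEq-∘ embed E))
          b-embed : ∀ i → b (embed (index i)) ≡ b i
          b-embed i = to (proj₁ E (embed (index i)) i) (a-embed i)

lemma3p1 : (lem : (ℓ : Level) → ExcludedMiddle ℓ) →
    (A : Set) (ρ : (m : ℕ) → Rel A m) →
    Infinite A →
    OmegaCategorical ρ →
    ((m : ℕ) → 1 ≤ m → Homogeneous (Upto ρ m)) →
    Rigid ρ →
    ((m : ℕ) → 1 ≤ m → KA (Upto ρ m) ≈ₛ sInv (Aut (Upto ρ m)))
    × (KA (AllRels ρ) ≈ₛ UnionKA ρ)
    × (KA (AllRels ρ) ≈ₛ InvCl (KA (AllRels ρ)))
    × (KA (AllRels ρ) ⊆ₛ sInv (Aut (KA (AllRels ρ))))
    × (Σ ℕ λ k → Σ (Rel A k) λ σ → sInv (Aut (KA (AllRels ρ))) k σ × ¬ KA (AllRels ρ) k σ)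
lemma3p1 lem A ρ infinite ω-categorical hom rigid =
  KA-Upto≈sInvAut ,
  KA-AllRels≈Union ,
  KA-AllRels≈InvCl (qf-stable infinite ω-categorical) ,
  KA-AllRels⊆sInvAut ,
  KA-AllRels⊂sInvAut infinite rigid
  where open Structure lem A ρ hom
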